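{- Let $n\ge 3$ and $k\in\{1,\dots,n-2\}$ be integers. Each of the tournaments $E_{2n+1}^{2k+1}$, $F_{2n+1}^{2k+1}$, $G_{2n+1}^{2k+1}$, $H_{2n+1}^{2k+1}$ is $(-1)$-critical, and its unique non-critical vertex is $2k+1$.
   Context: A tournament $T=(S,A)$ consists of a finite set $S$ and a set $A$ of ordered pairs of distinct elements of $S$ such that for all distinct $x,y\in S$ exactly one of $(x,y),(y,x)$ lies in $A$; write $x\to y$ for $(x,y)\in A$. For $X\subseteq S$, $T(X)$ is the induced subtournament and $T-x=T(S\setminus\{x\})$. A subset $I\subseteq S$ is an interval of $T$ if for all $a,b\in I$ and $x\in S\setminus I$, $(a,x)\in A$ iff $(b,x)\in A$. The sets $\emptyset$, $\{x\}$ and $S$ are the trivial intervals; $T$ is indecomposable if all its intervals are trivial, and decomposable otherwise. A vertex $x$ of an indecomposable tournament $T$ is critical if $T-x$ is decomposable. An indecomposable tournament with at least $5$ vertices is $(-1)$-critical if exactly one of its vertices is non-critical. For an integer $p\ge1$, the tournaments $U_{2p+1}$ and $V_{2p+1}$ on $\{0,\dots,2p\}$ are: in $U_{2p+1}$, for $i<j$, $i\to j$ if $i$ or $j$ is odd, and $j\to i$ if $i$ and $j$ are both even; in $V_{2p+1}$, $i\to j$ for $0\le i<j\le 2p-1$, and for $0\le i\le 2p-1$, $2p\to i$ if $i$ is even and $i\to 2p$ if $i$ is odd. For $n\ge 3$ and $1\le k\le n-2$, the tournaments below are on $\{0,\dots,2n\}$; put $P=\{0,\dots,2k\}$, $Q=\{2k+2,\dots,2n\}$.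 In each, every vertex of $P$ dominates $2k+1$ and $2k+1$ dominates every vertex of $Q$. Further: (E) $E_{2n+1}^{2k+1}$: on $P$, $i\to j$ iff $i<j$; on $Q$, $i\to j$ iff $i<j$; for $x\in Q$, $y\in P$: $x\to y$ if $x,y$ are both even, and $y\to x$ otherwise. (F) $F_{2n+1}^{2k+1}$: on $P$ the arcs of $U_{2k+1}$; on $Q$ and between $Q$ and $P$ as in $E_{2n+1}^{2k+1}$. (G) $G_{2n+1}^{2k+1}$: on $P$ the arcs of $U_{2k+1}$; on $Q$: $i\to j$ for $2k+2\le i<j\le 2n-1$, and for $j\in\{2k+2,\dots,2n-1\}$, $2n\to j$ if $j$ is even, $j\to 2n$ if $j$ is odd; for $x\in Q$, $y\in P$: $x\to y$ if $x=2n$ and $y$ is even, and $y\to x$ otherwise. (H) $H_{2n+1}^{2k+1}$: on $P$ the arcs of $V_{2k+1}$; on $Q$ as in $G_{2n+1}^{2k+1}$; for $x\in Q$, $y\in P$: $x\to y$ if $x=2n$ and $y=2k$, and $y\to x$ otherwise. -}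

module Defs where

open import Data.Nat using (ℕ; zero; suc; _+_; _*_; _≤_; _%_; _≡ᵇ_; _<ᵇ_)
open import Data.Bool using (Bool; true; false; not; _∧_; _∨_; if_then_else_)
open import Data.Fin using (Fin; toℕ)
open import Data.Fin.Subset using (Subset; _∈_; _∉_; _⊆_; ⊥; ⊤; ⁅_⁆; _-_)
open import Data.Product using (Σ; _×_; ∃; _,_)
open import Data.Sum using (_⊎_)
open import Relation.Binary.PropositionalEquality using (_≡_; _≢_)
open import Relation.Nullary using (¬_)

-- General notions.  A (candidate) tournament on the finite vertex set
-- Fin m is given by its arc relation  arc x y = true  iff  x → y.

Arcs : ℕ → Set
Arcs m = Fin m → Fin m → Bool

IsTournament : ∀ {m} → Arcs m → Set
IsTournament {m} arc =
  (∀ (x : Fin m) → arc x x ≡ false) ×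
  (∀ (x y : Fin m) → x ≢ y → arc y x ≡ not (arc x y))

IsInterval : ∀ {m} → Arcs m → Subset m → Subset m → Set
IsInterval {m} arc X I =
  I ⊆ X ×
  (∀ (a b x : Fin m) → a ∈ I → b ∈ I → x ∈ X → x ∉ I → arc a x ≡ arc b x)

IsTrivial : ∀ {m} → Subset m → Subset m → Set
IsTrivial {m} X I = I ≡ ⊥ ⊎ (∃ λ (y : Fin m) → I ≡ ⁅ y ⁆) ⊎ I ≡ X

IndecomposableOn : ∀ {m} → Arcs m → Subset m → Set
IndecomposableOn {m} arc X = ∀ (I : Subset m) → IsInterval arc X I → IsTrivial X I

Indecomposable : ∀ {m} → Arcs m → Set
Indecomposable arc = IndecomposableOn arc ⊤

-- x is critical: T - x is decomposable (T assumed indecomposable)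
Critical : ∀ {m} → Arcs m → Fin m → Set
Critical arc x = ¬ IndecomposableOn arc (⊤ - x)

MinusOneCritical : ∀ {m} → Arcs m → Set
MinusOneCritical {m} arc =
  Indecomposable arc × 5 ≤ m ×
  (∃ λ (v : Fin m) → ¬ Critical arc v × (∀ (w : Fin m) → ¬ Critical arc w → w ≡ v))

isEven : ℕ → Bool
isEven i = i % 2 ≡ᵇ 0

isOdd : ℕ → Bool
isOdd i = not (isEven i)

fromLT : (ℕ → ℕ → Bool) → ℕ → ℕ → Bool
fromLT r i j = if i <ᵇ j then r i j else (if j <ᵇ i then not (r j i) else false)

U< : ℕ → ℕ → Bool
U< i j = isOdd i ∨ isOdd j

-- V_{2p+1} with top vertex t = 2p, for i < j
V< : ℕ → ℕ → ℕ → Bool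
V< t i j = if j ≡ᵇ t then isOdd i else true

Tr< : ℕ → ℕ → Bool
Tr< i j = true

-- generic assembly on {0..2n}: P = {0..2k}, middle 2k+1, Q = {2k+2..2n}.
-- relP, relQ : arcs inside P, Q (for i < j); cross x y : whether x → y
-- for x ∈ Q, y ∈ P (otherwise y → x).
assemble : (k : ℕ) → (ℕ → ℕ → Bool) → (ℕ → ℕ → Bool) → (ℕ → ℕ → Bool) → ℕ → ℕ → Bool
assemble k relP relQ cross i j =
  if i ≡ᵇ j then false
  else if i ≡ᵇ mid then inQ j
  else if j ≡ᵇ mid then inP i
  else if inP i ∧ inP j then fromLT relP i j
  else if inQ i ∧ inQ j then fromLT relQ i j
  else if inQ i ∧ inP j then cross i j
  else not (cross j i)
  where
  mid : ℕ
  mid = 2 * k + 1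
  inP : ℕ → Bool
  inP x = x <ᵇ mid
  inQ : ℕ → Bool
  inQ x = mid <ᵇ x

crossEF : ℕ → ℕ → Bool
crossEF x y = isEven x ∧ isEven y

crossG : ℕ → ℕ → ℕ → Bool
crossG n x y = (x ≡ᵇ 2 * n) ∧ isEven y

crossH : ℕ → ℕ → ℕ → ℕ → Bool
crossH n k x y = (x ≡ᵇ 2 * n) ∧ (y ≡ᵇ 2 * k)

Eℕ Fℕ Gℕ Hℕ : ℕ → ℕ → ℕ → ℕ → Bool
Eℕ n k = assemble k Tr< Tr< crossEF
Fℕ n k = assemble k U< Tr< crossEF
Gℕ n k = assemble k U< (V< (2 * n)) (crossG n)
Hℕ n k = assemble k (V< (2 * k)) (V< (2 * n)) (crossH n k)

onFin : (n : ℕ) → (ℕ → ℕ → Bool) → Arcs (2 * n + 1)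
onFin n r x y = r (toℕ x) (toℕ y)

E F G H : (n k : ℕ) → Arcs (2 * n + 1)
E n k = onFin n (Eℕ n k)
F n k = onFin n (Fℕ n k)
G n k = onFin n (Gℕ n k)
H n k = onFin n (Hℕ n k)

MinusOneCriticalWithNonCritical : ∀ {m} → Arcs m → ℕ → Set
MinusOneCriticalWithNonCritical {m} T c =
  IsTournament T × MinusOneCritical T ×
  (∀ (v : Fin m) → toℕ v ≡ c → ¬ Critical T v)

-- Each of E, F, G and H is the transitive tournament 0 → 1 → ⋯ → 2n with the
-- arcs between certain pairs of even vertices reversed.  An odd vertex therefore
-- dominates every vertex above it and is dominated by every vertex below it, so
-- it separates any two vertices lying on either side of it.
--
-- Indecomposability of T and of T - (2k+1): an interval containing 0 and 2n
-- contains every odd vertex, and then every even one, which 1 and 2n-1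
-- separate; an interval with two elements reaches 0 and 2n by a short chase of
-- separators that depends on the family.  Criticality of every other vertex w:
-- T - 0 and T - 2n have evident intervals, and T - (w′+1) has the interval
-- {w′, w′+2}, except in G and H at w = 2n-1, where every vertex dominates 2n-2,
-- and in H at w = 2k-1, where {2k-2, 2k+1} is an interval instead.
module Submission where

open import Defs
open import Data.Nat using (ℕ; zero; suc; pred; _+_; _*_; _≤_; _<_; _%_; _≡ᵇ_; _<ᵇ_; z≤n; s≤s; >-nonZero)
open import Data.Nat.Properties hiding (even≢odd)
open import Data.Nat.DivMod using ([m+n]%n≡m%n)
open import Data.Bool using (Bool; true; false; not; _∧_; _∨_; T)
open import Data.Bool.Properties using (∧-zeroʳ; ∧-comm; ∧-identityʳ; ∨-zeroʳ; not-involutive)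
open import Data.Fin using (Fin; toℕ; fromℕ<; zero; suc)
open import Data.Fin.Properties using (toℕ-fromℕ<; toℕ-injective; toℕ<n)
open import Data.Fin.Subset using (Subset; _∈_; _∉_; _─_; _-_; ⊤; ⊥; ⁅_⁆; inside; outside)
open import Data.Fin.Subset.Properties using (_∈?_; ∈⊤; ∉⊥; x∈⁅x⁆; x∈⁅y⁆⇒x≡y; x∈p∧x≢y⇒x∈p-y; ⊆-antisym)
open import Data.Vec using ([]; _∷_; here; there; tabulate)
open import Data.Vec.Properties using (lookup∘tabulate; []=⇒lookup; lookup⇒[]=)
open import Data.Product using (Σ; _×_; ∃; _,_; proj₁; proj₂)
open import Data.Sum using (_⊎_; inj₁; inj₂)
open import Data.Empty using (⊥-elim)
open import Relation.Binary.PropositionalEquality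
open import Relation.Binary.Definitions using (tri<; tri≈; tri>)
open import Relation.Nullary using (¬_; Dec; yes; no)
open import Function using (_∘′_)

true≢false : true ≢ false
true≢false ()

T⇒≡true : ∀ {b} → T b → b ≡ true
T⇒≡true {true} _ = refl

<⇒<ᵇ≡true : ∀ {a b} → a < b → (a <ᵇ b) ≡ true
<⇒<ᵇ≡true = T⇒≡true ∘′ <⇒<ᵇ

<ᵇ≡true⇒< : ∀ {a b} → (a <ᵇ b) ≡ true → a < b
<ᵇ≡true⇒< {a} {b} e = <ᵇ⇒< a b (subst T (sym e) _)

≥⇒<ᵇ≡false : ∀ {a b} → b ≤ a → (a <ᵇ b) ≡ false
≥⇒<ᵇ≡false {a} {b} b≤a with a <ᵇ b in e
... | false = refl
... | true = ⊥-elim (<⇒≱ (<ᵇ≡true⇒< e) b≤a)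

<ᵇ≡false⇒≥ : ∀ {a b} → (a <ᵇ b) ≡ false → b ≤ a
<ᵇ≡false⇒≥ e = ≮⇒≥ λ a<b → true≢false (trans (sym (<⇒<ᵇ≡true a<b)) e)

≡ᵇ-refl : ∀ a → (a ≡ᵇ a) ≡ true
≡ᵇ-refl a = T⇒≡true (≡⇒≡ᵇ a a refl)

≡ᵇ≡true⇒≡ : ∀ {a b} → (a ≡ᵇ b) ≡ true → a ≡ b
≡ᵇ≡true⇒≡ {a} {b} e = ≡ᵇ⇒≡ a b (subst T (sym e) _)

≡ᵇ≡false⇒≢ : ∀ {a b} → (a ≡ᵇ b) ≡ false → a ≢ b
≡ᵇ≡false⇒≢ {a} e refl = true≢false (trans (sym (≡ᵇ-refl a)) e)

∨-true : ∀ {a b} → a ∨ b ≡ true → a ≡ true ⊎ b ≡ true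
∨-true {true} _ = inj₁ refl
∨-true {false} b≡true = inj₂ b≡true

∨-false : ∀ {a b} → a ∨ b ≡ false → a ≡ false × b ≡ false
∨-false {false} b≡false = refl , b≡false

≢⇒≡ᵇ≡false : ∀ {a b} → a ≢ b → (a ≡ᵇ b) ≡ false
≢⇒≡ᵇ≡false {a} {b} a≢b with a ≡ᵇ b in e
... | false = refl
... | true = ⊥-elim (a≢b (≡ᵇ≡true⇒≡ e))

<ᵇ-+2ˡ : ∀ {w c} → suc w ≢ c → suc (suc w) ≢ c → (w <ᵇ c) ≡ (suc (suc w) <ᵇ c)
<ᵇ-+2ˡ {w} {c} w+1≢c w+2≢c with <-cmp w c
... | tri< w<c _ _ = trans (<⇒<ᵇ≡true w<c) (sym (<⇒<ᵇ≡true (≤∧≢⇒< (≤∧≢⇒< w<c w+1≢c) w+2≢c)))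
... | tri≈ _ refl _ = trans (≥⇒<ᵇ≡false (≤-refl {w})) (sym (≥⇒<ᵇ≡false (m≤n+m w 2)))
... | tri> _ _ c<w = trans (≥⇒<ᵇ≡false (<⇒≤ c<w)) (sym (≥⇒<ᵇ≡false (≤-trans (<⇒≤ c<w) (m≤n+m w 2))))

<ᵇ-+2ʳ : ∀ {w c} → w ≢ c → suc w ≢ c → (c <ᵇ w) ≡ (c <ᵇ suc (suc w))
<ᵇ-+2ʳ {w} {c} w≢c w+1≢c with <-cmp c w
... | tri< c<w _ _ = trans (<⇒<ᵇ≡true c<w) (sym (<⇒<ᵇ≡true (<-trans c<w (m<n+m w (s≤s z≤n)))))
... | tri≈ _ c≡w _ = ⊥-elim (w≢c (sym c≡w))
... | tri> _ _ w<c = trans (≥⇒<ᵇ≡false (<⇒≤ w<c)) (sym (≥⇒<ᵇ≡false (≤∧≢⇒< w<c w+1≢c)))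

isEven-+2 : ∀ u → isEven (2 + u) ≡ isEven u
isEven-+2 u = cong (_≡ᵇ 0) (trans (cong (_% 2) (+-comm 2 u)) ([m+n]%n≡m%n u 2))

isEven-suc : ∀ u → isEven (suc u) ≡ not (isEven u)
isEven-suc zero = refl
isEven-suc (suc u) = begin
  isEven (2 + u)             ≡⟨ isEven-+2 u ⟩
  isEven u                   ≡⟨ not-involutive (isEven u) ⟨
  not (not (isEven u))       ≡⟨ cong not (isEven-suc u) ⟨
  not (isEven (suc u))       ∎
  where open ≡-Reasoning

parity-suc : ∀ {u b} → isEven u ≡ b → isEven (suc u) ≡ not b
parity-suc {u} e = trans (isEven-suc u) (cong not e)

parity-pred : ∀ {u b} → isEven (suc u) ≡ b → isEven u ≡ not b
parity-pred {u} e = trans (sym (not-involutive _)) (cong not (trans (sym (isEven-suc u)) e))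

isEven-2* : ∀ k → isEven (2 * k) ≡ true
isEven-2* zero = refl
isEven-2* (suc k) = trans (cong isEven (*-suc 2 k)) (trans (isEven-+2 (2 * k)) (isEven-2* k))

isEven-2*+1 : ∀ k → isEven (2 * k + 1) ≡ false
isEven-2*+1 k = trans (cong isEven (+-comm (2 * k) 1)) (parity-suc {2 * k} (isEven-2* k))

even≢odd : ∀ {a b} → isEven a ≡ true → isEven b ≡ false → a ≢ b
even≢odd ea eb refl = true≢false (trans (sym ea) eb)

odd≢even : ∀ {a b} → isEven a ≡ false → isEven b ≡ true → a ≢ b
odd≢even ea eb = ≢-sym (even≢odd eb ea)

odd⇒0< : ∀ {u} → isEven u ≡ false → 0 < u
odd⇒0< eu = ≤∧≢⇒< z≤n (even≢odd refl eu)

even-or-odd : ∀ u → isEven u ≡ true ⊎ isEven u ≡ false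
even-or-odd u with isEven u
... | true = inj₁ refl
... | false = inj₂ refl

-- Transitive tournaments with reversed even pairs

evenPair : (ℕ → ℕ → Bool) → ℕ → ℕ → Bool
evenPair R u v = isEven u ∧ (isEven v ∧ R u v)

evenPair-oddˡ : ∀ R u v → isEven u ≡ false → evenPair R u v ≡ false
evenPair-oddˡ R u v e rewrite e = refl

evenPair-oddʳ : ∀ R u v → isEven v ≡ false → evenPair R u v ≡ false
evenPair-oddʳ R u v e rewrite e = ∧-zeroʳ (isEven u)

evenPair-even : ∀ R u v → isEven u ≡ true → isEven v ≡ true → evenPair R u v ≡ R u v
evenPair-even R u v eu ev rewrite eu | ev = refl

evenPair-unrelated : ∀ R u v → R u v ≡ false → evenPair R u v ≡ false
evenPair-unrelated R u v e rewrite e | ∧-zeroʳ (isEven v) = ∧-zeroʳ (isEven u)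

evenPair-related : ∀ R u v → R u v ≡ true → evenPair R u v ≡ isEven u ∧ isEven v
evenPair-related R u v e rewrite e | ∧-identityʳ (isEven v) = refl

record EvenReversal (R r : ℕ → ℕ → Bool) : Set where
  field
    irreflexive : ∀ u → r u u ≡ false
    upward : ∀ {u v} → u < v → r u v ≡ not (evenPair R u v)
    downward : ∀ {u v} → u < v → r v u ≡ evenPair R u v

  up-oddˡ : ∀ {u v} → u < v → isEven u ≡ false → r u v ≡ true
  up-oddˡ {u} {v} u<v e = trans (upward u<v) (cong not (evenPair-oddˡ R u v e))

  up-oddʳ : ∀ {u v} → u < v → isEven v ≡ false → r u v ≡ true
  up-oddʳ {u} {v} u<v e = trans (upward u<v) (cong not (evenPair-oddʳ R u v e))

  down-oddˡ : ∀ {u v} → u < v → isEven u ≡ false → r v u ≡ false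
  down-oddˡ {u} {v} u<v e = trans (downward u<v) (evenPair-oddˡ R u v e)

  down-oddʳ : ∀ {u v} → u < v → isEven v ≡ false → r v u ≡ false
  down-oddʳ {u} {v} u<v e = trans (downward u<v) (evenPair-oddʳ R u v e)

  up-even : ∀ {u v b} → u < v → isEven u ≡ true → isEven v ≡ true → R u v ≡ b → r u v ≡ not b
  up-even {u} {v} u<v eu ev e = trans (upward u<v) (cong not (trans (evenPair-even R u v eu ev) e))

  down-even : ∀ {u v b} → u < v → isEven u ≡ true → isEven v ≡ true → R u v ≡ b → r v u ≡ b
  down-even {u} {v} u<v eu ev e = trans (downward u<v) (trans (evenPair-even R u v eu ev) e)

  isTournament : ∀ n → IsTournament (onFin n r)
  isTournament n = (λ x → irreflexive (toℕ x)) , antisymmetric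
    where
    antisymmetric : ∀ x y → x ≢ y → onFin n r y x ≡ not (onFin n r x y)
    antisymmetric x y x≢y with <-cmp (toℕ x) (toℕ y)
    ... | tri< x<y _ _ = trans (downward x<y) (sym (trans (cong not (upward x<y)) (not-involutive _)))
    ... | tri≈ _ x≡y _ = ⊥-elim (x≢y (toℕ-injective x≡y))
    ... | tri> _ _ y<x = trans (upward y<x) (cong not (sym (downward y<x)))

module Assembly (k : ℕ) (relP relQ cross : ℕ → ℕ → Bool) where
  private
    mid : ℕ
    mid = 2 * k + 1

    A : ℕ → ℕ → Bool
    A = assemble k relP relQ cross

  within-P : ∀ {u v} → u < v → v < mid → A u v ≡ relP u v × A v u ≡ not (relP u v)
  within-P p q
    rewrite ≢⇒≡ᵇ≡false (<⇒≢ p) | ≢⇒≡ᵇ≡false (>⇒≢ p)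
          | ≢⇒≡ᵇ≡false (<⇒≢ (<-trans p q)) | ≢⇒≡ᵇ≡false (<⇒≢ q)
          | <⇒<ᵇ≡true (<-trans p q) | <⇒<ᵇ≡true q
          | <⇒<ᵇ≡true p | ≥⇒<ᵇ≡false (<⇒≤ p) = refl , refl

  P-to-mid : ∀ {u} → u < mid → A u mid ≡ true × A mid u ≡ false
  P-to-mid p
    rewrite ≢⇒≡ᵇ≡false (<⇒≢ p) | ≢⇒≡ᵇ≡false (>⇒≢ p) | ≡ᵇ-refl mid
          | <⇒<ᵇ≡true p | ≥⇒<ᵇ≡false (<⇒≤ p) = refl , refl

  P-to-Q : ∀ {u v} → u < mid → mid < v → A u v ≡ not (cross v u) × A v u ≡ cross v u
  P-to-Q p q
    rewrite ≢⇒≡ᵇ≡false (<⇒≢ (<-trans p q)) | ≢⇒≡ᵇ≡false (>⇒≢ (<-trans p q))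
          | ≢⇒≡ᵇ≡false (<⇒≢ p) | ≢⇒≡ᵇ≡false (>⇒≢ q)
          | <⇒<ᵇ≡true p | <⇒<ᵇ≡true q
          | ≥⇒<ᵇ≡false (<⇒≤ q) | ≥⇒<ᵇ≡false (<⇒≤ p) = refl , refl

  mid-to-Q : ∀ {v} → mid < v → A mid v ≡ true × A v mid ≡ false
  mid-to-Q q
    rewrite ≢⇒≡ᵇ≡false (<⇒≢ q) | ≢⇒≡ᵇ≡false (>⇒≢ q) | ≡ᵇ-refl mid
          | <⇒<ᵇ≡true q | ≥⇒<ᵇ≡false (<⇒≤ q) = refl , refl

  within-Q : ∀ {u v} → mid < u → u < v → A u v ≡ relQ u v × A v u ≡ not (relQ u v)
  within-Q p q
    rewrite ≢⇒≡ᵇ≡false (<⇒≢ q) | ≢⇒≡ᵇ≡false (>⇒≢ q)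
          | ≢⇒≡ᵇ≡false (>⇒≢ p) | ≢⇒≡ᵇ≡false (>⇒≢ (<-trans p q))
          | ≥⇒<ᵇ≡false (<⇒≤ p) | ≥⇒<ᵇ≡false (<⇒≤ (<-trans p q))
          | <⇒<ᵇ≡true p | <⇒<ᵇ≡true (<-trans p q)
          | <⇒<ᵇ≡true q | ≥⇒<ᵇ≡false (<⇒≤ q) = refl , refl

  module _ (R : ℕ → ℕ → Bool)
    (onP : ∀ {u v} → u < v → v < mid → relP u v ≡ not (evenPair R u v))
    (onQ : ∀ {u v} → mid < u → u < v → relQ u v ≡ not (evenPair R u v))
    (across : ∀ {u v} → u < mid → mid < v → cross v u ≡ evenPair R u v) where

    private
      irreflexive : ∀ u → A u u ≡ false
      irreflexive u rewrite ≡ᵇ-refl u = refl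

      Oriented : ℕ → ℕ → Set
      Oriented u v = A u v ≡ not (evenPair R u v) × A v u ≡ evenPair R u v

      oriented-by : ∀ u v {c} → A u v ≡ c × A v u ≡ not c → c ≡ not (evenPair R u v) → Oriented u v
      oriented-by u v (e₁ , e₂) refl = e₁ , trans e₂ (not-involutive _)

      oriented-by′ : ∀ u v {c} → A u v ≡ not c × A v u ≡ c → c ≡ evenPair R u v → Oriented u v
      oriented-by′ u v es refl = es

      mid-odd : ∀ u → evenPair R u mid ≡ false × evenPair R mid u ≡ false
      mid-odd u = evenPair-oddʳ R u mid (isEven-2*+1 k) , evenPair-oddˡ R mid u (isEven-2*+1 k)

      oriented : ∀ {u v} → u < v → Oriented u v
      oriented {u} {v} u<v with <-cmp u mid | <-cmp v mid
      ... | tri< p _ _ | tri< q _ _ = oriented-by u v (within-P u<v q) (onP u<v q)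
      ... | tri< p _ _ | tri≈ _ refl _ = oriented-by′ u v {false} (P-to-mid p) (sym (proj₁ (mid-odd u)))
      ... | tri< p _ _ | tri> _ _ q = oriented-by′ u v (P-to-Q p q) (across p q)
      ... | tri≈ _ refl _ | tri< q _ _ = ⊥-elim (<-asym u<v q)
      ... | tri≈ _ refl _ | tri≈ _ refl _ = ⊥-elim (<-irrefl refl u<v)
      ... | tri≈ _ refl _ | tri> _ _ q = oriented-by′ u v {false} (mid-to-Q q) (sym (proj₂ (mid-odd v)))
      ... | tri> _ _ p | tri< q _ _ = ⊥-elim (<-asym (<-trans p u<v) q)
      ... | tri> _ _ p | tri≈ _ refl _ = ⊥-elim (<-asym p u<v)
      ... | tri> _ _ p | tri> _ _ q = oriented-by u v (within-Q p u<v) (onQ p u<v)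

    assemble-evenReversal : EvenReversal R A
    assemble-evenReversal = record
      { irreflexive = irreflexive
      ; upward = proj₁ ∘′ oriented
      ; downward = proj₂ ∘′ oriented
      }

-- The downward arcs of E, F, G and H join exactly the even pairs u < v selected
-- by flipsE, flipsF, flipsG and flipsH respectively.
flipsE flipsF : ℕ → ℕ → ℕ → Bool
flipsE k u v = (u <ᵇ 2 * k + 1) ∧ (2 * k + 1 <ᵇ v)
flipsF k u v = u <ᵇ 2 * k + 1

flipsG flipsH : ℕ → ℕ → ℕ → ℕ → Bool
flipsG n k u v = (v <ᵇ 2 * k + 1) ∨ (v ≡ᵇ 2 * n)
flipsH n k u v = (v ≡ᵇ 2 * k) ∨ ((v ≡ᵇ 2 * n) ∧ not (u <ᵇ 2 * k))

U<-evenPair : ∀ R u v → R u v ≡ true → U< u v ≡ not (evenPair R u v)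
U<-evenPair R u v e rewrite evenPair-related R u v e with isEven u | isEven v
... | true | true = refl
... | true | false = refl
... | false | _ = refl

crossEF-evenPair : ∀ R u v → R u v ≡ true → crossEF v u ≡ evenPair R u v
crossEF-evenPair R u v e = trans (∧-comm (isEven v) (isEven u)) (sym (evenPair-related R u v e))

Tr<-evenPair : ∀ R u v → R u v ≡ false → Tr< u v ≡ not (evenPair R u v)
Tr<-evenPair R u v e = cong not (sym (evenPair-unrelated R u v e))

E-evenReversal : ∀ n k → EvenReversal (flipsE k) (Eℕ n k)
E-evenReversal n k = Assembly.assemble-evenReversal k Tr< Tr< crossEF (flipsE k) onP onQ across
  where
  onP : ∀ {u v} → u < v → v < 2 * k + 1 → Tr< u v ≡ not (evenPair (flipsE k) u v)
  onP {u} {v} _ q = Tr<-evenPair (flipsE k) u v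
    (trans (cong ((u <ᵇ 2 * k + 1) ∧_) (≥⇒<ᵇ≡false (<⇒≤ q))) (∧-zeroʳ _))
  onQ : ∀ {u v} → 2 * k + 1 < u → u < v → Tr< u v ≡ not (evenPair (flipsE k) u v)
  onQ {u} {v} p _ = Tr<-evenPair (flipsE k) u v (cong (_∧ (2 * k + 1 <ᵇ v)) (≥⇒<ᵇ≡false (<⇒≤ p)))
  across : ∀ {u v} → u < 2 * k + 1 → 2 * k + 1 < v → crossEF v u ≡ evenPair (flipsE k) u v
  across {u} {v} p q = crossEF-evenPair (flipsE k) u v (cong₂ _∧_ (<⇒<ᵇ≡true p) (<⇒<ᵇ≡true q))

F-evenReversal : ∀ n k → EvenReversal (flipsF k) (Fℕ n k)
F-evenReversal n k = Assembly.assemble-evenReversal k U< Tr< crossEF (flipsF k) onP onQ across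
  where
  onP : ∀ {u v} → u < v → v < 2 * k + 1 → U< u v ≡ not (evenPair (flipsF k) u v)
  onP {u} {v} p q = U<-evenPair (flipsF k) u v (<⇒<ᵇ≡true (<-trans p q))
  onQ : ∀ {u v} → 2 * k + 1 < u → u < v → Tr< u v ≡ not (evenPair (flipsF k) u v)
  onQ {u} {v} p _ = Tr<-evenPair (flipsF k) u v (≥⇒<ᵇ≡false (<⇒≤ p))
  across : ∀ {u v} → u < 2 * k + 1 → 2 * k + 1 < v → crossEF v u ≡ evenPair (flipsF k) u v
  across {u} {v} p _ = crossEF-evenPair (flipsF k) u v (<⇒<ᵇ≡true p)

G-evenReversal : ∀ n k → EvenReversal (flipsG n k) (Gℕ n k)
G-evenReversal n k = Assembly.assemble-evenReversal k U< (V< (2 * n)) (crossG n) (flipsG n k) onP onQ across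
  where
  onP : ∀ {u v} → u < v → v < 2 * k + 1 → U< u v ≡ not (evenPair (flipsG n k) u v)
  onP {u} {v} _ q = U<-evenPair (flipsG n k) u v (cong (_∨ (v ≡ᵇ 2 * n)) (<⇒<ᵇ≡true q))
  onQ : ∀ {u v} → 2 * k + 1 < u → u < v → V< (2 * n) u v ≡ not (evenPair (flipsG n k) u v)
  onQ {u} {v} p q with v ≟ 2 * n
  ... | yes refl rewrite ≡ᵇ-refl (2 * n) | ≥⇒<ᵇ≡false (<⇒≤ (<-trans p q))
                       | isEven-2* n | ∧-identityʳ (isEven u) = refl
  ... | no v≢2n rewrite ≢⇒≡ᵇ≡false v≢2n | ≥⇒<ᵇ≡false (<⇒≤ (<-trans p q))
                      | ∧-zeroʳ (isEven v) | ∧-zeroʳ (isEven u) = refl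
  across : ∀ {u v} → u < 2 * k + 1 → 2 * k + 1 < v → crossG n v u ≡ evenPair (flipsG n k) u v
  across {u} {v} p q with v ≟ 2 * n
  ... | yes refl rewrite ≡ᵇ-refl (2 * n) | ≥⇒<ᵇ≡false (<⇒≤ q)
                       | isEven-2* n | ∧-identityʳ (isEven u) = refl
  ... | no v≢2n rewrite ≢⇒≡ᵇ≡false v≢2n | ≥⇒<ᵇ≡false (<⇒≤ q)
                      | ∧-zeroʳ (isEven v) | ∧-zeroʳ (isEven u) = refl

H-evenReversal : ∀ n k → 2 * k + 1 ≤ 2 * n → EvenReversal (flipsH n k) (Hℕ n k)
H-evenReversal n k 2k+1≤2n =
  Assembly.assemble-evenReversal k (V< (2 * k)) (V< (2 * n)) (crossH n k) (flipsH n k) onP onQ across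
  where
  2k<2n : 2 * k < 2 * n
  2k<2n = <-≤-trans (m<m+n (2 * k) (s≤s z≤n)) 2k+1≤2n
  onP : ∀ {u v} → u < v → v < 2 * k + 1 → V< (2 * k) u v ≡ not (evenPair (flipsH n k) u v)
  onP {u} {v} p q with v ≟ 2 * k
  ... | yes refl rewrite ≡ᵇ-refl (2 * k) | isEven-2* k | ∧-identityʳ (isEven u) = refl
  ... | no v≢2k rewrite ≢⇒≡ᵇ≡false v≢2k | ≢⇒≡ᵇ≡false (<⇒≢ (<-≤-trans q 2k+1≤2n))
                      | ∧-zeroʳ (isEven v) | ∧-zeroʳ (isEven u) = refl
  onQ : ∀ {u v} → 2 * k + 1 < u → u < v → V< (2 * n) u v ≡ not (evenPair (flipsH n k) u v)
  onQ {u} {v} p q with v ≟ 2 * n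
  ... | yes refl rewrite ≡ᵇ-refl (2 * n) | ≢⇒≡ᵇ≡false (>⇒≢ 2k<2n)
                       | ≥⇒<ᵇ≡false (<⇒≤ (≤-<-trans (m≤m+n (2 * k) 1) p))
                       | isEven-2* n | ∧-identityʳ (isEven u) = refl
  ... | no v≢2n rewrite ≢⇒≡ᵇ≡false v≢2n | ≢⇒≡ᵇ≡false (>⇒≢ (<-trans (≤-<-trans (m≤m+n (2 * k) 1) p) q))
                      | ∧-zeroʳ (isEven v) | ∧-zeroʳ (isEven u) = refl
  across : ∀ {u v} → u < 2 * k + 1 → 2 * k + 1 < v → crossH n k v u ≡ evenPair (flipsH n k) u v
  across {u} {v} p q with v ≟ 2 * n | <-cmp u (2 * k)
  ... | no v≢2n | _ rewrite ≢⇒≡ᵇ≡false v≢2n | ≢⇒≡ᵇ≡false (>⇒≢ (≤-<-trans (m≤m+n (2 * k) 1) q))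
                          | ∧-zeroʳ (isEven v) | ∧-zeroʳ (isEven u) = refl
  ... | yes refl | tri< u<2k _ _
      rewrite ≡ᵇ-refl (2 * n) | ≢⇒≡ᵇ≡false (<⇒≢ u<2k) | <⇒<ᵇ≡true u<2k
            | ≢⇒≡ᵇ≡false (>⇒≢ 2k<2n) | ∧-zeroʳ (isEven (2 * n)) | ∧-zeroʳ (isEven u) = refl
  ... | yes refl | tri≈ _ refl _
      rewrite ≡ᵇ-refl (2 * n) | ≡ᵇ-refl (2 * k) | ≥⇒<ᵇ≡false (≤-refl {2 * k})
            | ≢⇒≡ᵇ≡false (>⇒≢ 2k<2n) | isEven-2* n | isEven-2* k = refl
  ... | _ | tri> _ _ 2k<u = ⊥-elim (<⇒≱ 2k<u (≤-pred (subst (u <_) (+-comm (2 * k) 1) p)))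

infix 4 _∈ℕ_

_∈ℕ_ : ∀ {m} → ℕ → Subset m → Set
_∈ℕ_ {m} u S = Σ (Fin m) λ x → toℕ x ≡ u × x ∈ S

<2n+1⇒≤2n : ∀ {u n} → u < 2 * n + 1 → u ≤ 2 * n
<2n+1⇒≤2n {u} {n} p = ≤-pred (subst (u <_) (+-comm (2 * n) 1) p)

label≤ : ∀ {n u} {S : Subset (2 * n + 1)} → u ∈ℕ S → u ≤ 2 * n
label≤ {n} (x , refl , _) = <2n+1⇒≤2n {n = n} (toℕ<n x)

module IntervalOf {n : ℕ} {r : ℕ → ℕ → Bool} {X I : Subset (2 * n + 1)}
  (iv : IsInterval (onFin n r) X I) where

  separator-∈ : ∀ {a b z} → a ∈ℕ I → b ∈ℕ I → z ∈ℕ X → r a z ≡ true → r b z ≡ false → z ∈ℕ I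
  separator-∈ (x , refl , xI) (y , refl , yI) (w , refl , wX) xw ¬yw with w ∈? I
  ... | yes wI = w , refl , wI
  ... | no w∉I = ⊥-elim (true≢false (trans (sym xw) (trans (proj₂ iv x y w xI yI wX w∉I) ¬yw)))

  ≡-by-labels : (∀ {u} → u ∈ℕ X → u ∈ℕ I) → I ≡ X
  ≡-by-labels X⊆I = ⊆-antisym (proj₁ iv) λ {x} xX → ∈-of-label (X⊆I (x , refl , xX))
    where
    ∈-of-label : ∀ {x} → toℕ x ∈ℕ I → x ∈ I
    ∈-of-label (y , e , yI) = subst (_∈ I) (toℕ-injective e) yI

module Bounds {n k : ℕ} (1≤k : 1 ≤ k) (k+2≤n : k + 2 ≤ n) where
  2k+4≤2n : 2 * k + 4 ≤ 2 * n
  2k+4≤2n = subst (_≤ 2 * n) (*-distribˡ-+ 2 k 2) (*-monoʳ-≤ 2 k+2≤n)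

  2k<2k+1 : 2 * k < 2 * k + 1
  2k<2k+1 = m<m+n (2 * k) (s≤s z≤n)

  0<2k : 0 < 2 * k
  0<2k = <-≤-trans (s≤s z≤n) (*-monoʳ-≤ 2 1≤k)

  1<2k+1 : 1 < 2 * k + 1
  1<2k+1 = ≤-<-trans 0<2k 2k<2k+1

  0<2k+1 : 0 < 2 * k + 1
  0<2k+1 = <-trans (s≤s z≤n) 1<2k+1

  2k+3<2n : 2 * k + 3 < 2 * n
  2k+3<2n = subst (_≤ 2 * n) (+-suc (2 * k) 3) 2k+4≤2n

  penult : ℕ
  penult = pred (2 * n)

  suc-penult : suc penult ≡ 2 * n
  suc-penult = suc-pred (2 * n) {{>-nonZero (≤-<-trans z≤n 2k+3<2n)}}

  penult<2n : penult < 2 * n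
  penult<2n = subst (penult <_) suc-penult ≤-refl

  2k+1<penult : 2 * k + 1 < penult
  2k+1<penult = <-≤-trans (+-monoʳ-< (2 * k) (s≤s (s≤s z≤n)))
    (≤-pred (subst (2 * k + 3 <_) (sym suc-penult) 2k+3<2n))

  2k+1<2n : 2 * k + 1 < 2 * n
  2k+1<2n = <-trans 2k+1<penult penult<2n

  2k<2n : 2 * k < 2 * n
  2k<2n = <-trans 2k<2k+1 2k+1<2n

  1<penult : 1 < penult
  1<penult = <-trans 1<2k+1 2k+1<penult

  isEven-2n : isEven (2 * n) ≡ true
  isEven-2n = isEven-2* n

  isEven-2k : isEven (2 * k) ≡ true
  isEven-2k = isEven-2* k

  isEven-2k+1 : isEven (2 * k + 1) ≡ false
  isEven-2k+1 = isEven-2*+1 k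

  2k+2<2n : suc (2 * k + 1) < 2 * n
  2k+2<2n = ≤-<-trans 2k+1<penult penult<2n

  isEven-2k+2 : isEven (suc (2 * k + 1)) ≡ true
  isEven-2k+2 = parity-suc {2 * k + 1} isEven-2k+1

  isEven-penult : isEven penult ≡ false
  isEven-penult = parity-pred {penult} (trans (cong isEven suc-penult) isEven-2n)

-- Indecomposability of T and of T - (2k+1)

ContainsAllBut : ∀ n → ℕ → Subset (2 * n + 1) → Set
ContainsAllBut n c X = ∀ {u} → u ≤ 2 * n → u ≢ c → u ∈ℕ X

module Indecomposability {n k : ℕ} (1≤k : 1 ≤ k) (k+2≤n : k + 2 ≤ n)
  {R r : ℕ → ℕ → Bool} (er : EvenReversal R r)
  {X : Subset (2 * n + 1)} (covers : ContainsAllBut n (2 * k + 1) X)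
  {I : Subset (2 * n + 1)} (iv : IsInterval (onFin n r) X I) where

  open Bounds 1≤k k+2≤n public
  open EvenReversal er public
  open IntervalOf {n} {r} iv public

  0∈X : 0 ∈ℕ X
  0∈X = covers z≤n (<⇒≢ 0<2k+1)

  2n∈X : 2 * n ∈ℕ X
  2n∈X = covers ≤-refl (>⇒≢ 2k+1<2n)

  odd-label<2n : ∀ {o} {S : Subset (2 * n + 1)} → isEven o ≡ false → o ∈ℕ S → o < 2 * n
  odd-label<2n oo o∈S = ≤∧≢⇒< (label≤ {n} o∈S) (odd≢even oo isEven-2n)

  1∈X : 1 ∈ℕ X
  1∈X = covers (<⇒≤ (<-trans 1<penult penult<2n)) (<⇒≢ 1<2k+1)

  penult∈X : penult ∈ℕ X
  penult∈X = covers (<⇒≤ penult<2n) (>⇒≢ 2k+1<penult)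

  Ends : Set
  Ends = 0 ∈ℕ I × 2 * n ∈ℕ I

  ends⇒≡ : Ends → I ≡ X
  ends⇒≡ (0∈I , 2n∈I) = ≡-by-labels all∈
    where
    odd∈ : ∀ {u} → isEven u ≡ false → u ∈ℕ X → u ∈ℕ I
    odd∈ ou u∈X = separator-∈ 0∈I 2n∈I u∈X (up-oddʳ (odd⇒0< ou) ou) (down-oddˡ (odd-label<2n ou u∈X) ou)

    1∈I : 1 ∈ℕ I
    1∈I = odd∈ refl 1∈X

    penult∈I : penult ∈ℕ I
    penult∈I = odd∈ isEven-penult penult∈X

    even∈ : ∀ {u} → isEven u ≡ true → u ∈ℕ X → u ∈ℕ I
    even∈ {u} eu u∈X with u ≟ 0 | u ≟ 2 * n
    ... | yes u≡0 | _ = subst (_∈ℕ I) (sym u≡0) 0∈I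
    ... | no _ | yes u≡2n = subst (_∈ℕ I) (sym u≡2n) 2n∈I
    ... | no u≢0 | no u≢2n =
      separator-∈ 1∈I penult∈I u∈X (up-oddˡ 1<u refl) (down-oddʳ u<penult isEven-penult)
      where
      1<u : 1 < u
      1<u = ≤∧≢⇒< (≤∧≢⇒< z≤n (≢-sym u≢0)) (odd≢even refl eu)
      u<penult : u < penult
      u<penult = ≤∧≢⇒< (≤-pred (subst (u <_) (sym suc-penult) (≤∧≢⇒< (label≤ {n} u∈X) u≢2n)))
                       (even≢odd eu isEven-penult)

    all∈ : ∀ {u} → u ∈ℕ X → u ∈ℕ I
    all∈ {u} u∈X with even-or-odd u
    ... | inj₁ eu = even∈ eu u∈X
    ... | inj₂ ou = odd∈ ou u∈X

  MixedPairsReachEnds : Set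
  MixedPairsReachEnds = ∀ {o e} → isEven o ≡ false → isEven e ≡ true → o ∈ℕ I → e ∈ℕ I → Ends

  -- 2k+1, which may be missing from X, is the only vertex separating 2k from 2k+2.
  StraddlingPairReachesEnds : Set
  StraddlingPairReachesEnds = 2 * k ∈ℕ I → suc (2 * k + 1) ∈ℕ I → Ends

  module _ (mixed : MixedPairsReachEnds) (straddling : StraddlingPairReachesEnds) where
    private
      even-pair : ∀ {a b} → isEven a ≡ true → isEven b ≡ true → a < b → a ∈ℕ I → b ∈ℕ I → Ends
      even-pair {a} {suc b} ea eb a<b a∈I b+1∈I with suc a ≟ 2 * k + 1 | b ≟ 2 * k + 1
      ... | no a+1≢2k+1 | _ = mixed oa+1 ea a+1∈I a∈I
        where
        oa+1 : isEven (suc a) ≡ false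
        oa+1 = parity-suc {a} ea
        a+1∈I : suc a ∈ℕ I
        a+1∈I = separator-∈ a∈I b+1∈I (covers (≤-trans a<b (label≤ {n} b+1∈I)) a+1≢2k+1)
          (up-oddʳ (n<1+n a) oa+1) (down-oddˡ (≤∧≢⇒< a<b (odd≢even oa+1 eb)) oa+1)
      ... | yes a+1≡2k+1 | yes refl =
        straddling (subst (_∈ℕ I) (suc-injective (trans a+1≡2k+1 (+-comm (2 * k) 1))) a∈I) b+1∈I
      ... | yes _ | no b≢2k+1 = mixed ob ea b∈I a∈I
        where
        ob : isEven b ≡ false
        ob = parity-pred {b} eb
        b∈I : b ∈ℕ I
        b∈I = separator-∈ a∈I b+1∈I (covers (≤-trans (n≤1+n b) (label≤ {n} b+1∈I)) b≢2k+1)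
          (up-oddʳ (≤∧≢⇒< (≤-pred a<b) (even≢odd ea ob)) ob) (down-oddˡ (n<1+n b) ob)

      ordered : ∀ {a b} → a < b → a ∈ℕ I → b ∈ℕ I → Ends
      ordered {a} {b} a<b a∈I b∈I with even-or-odd a | even-or-odd b
      ... | inj₁ ea | inj₁ eb = even-pair ea eb a<b a∈I b∈I
      ... | inj₁ ea | inj₂ ob = mixed ob ea b∈I a∈I
      ... | inj₂ oa | inj₁ eb = mixed oa eb a∈I b∈I
      ... | inj₂ oa | inj₂ ob = mixed oa ea+1 a∈I a+1∈I
        where
        ea+1 : isEven (suc a) ≡ true
        ea+1 = parity-suc {a} oa
        a+1∈I : suc a ∈ℕ I
        a+1∈I = separator-∈ a∈I b∈I (covers (≤-trans a<b (label≤ {n} b∈I)) (even≢odd ea+1 isEven-2k+1))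
          (up-oddˡ (n<1+n a) oa) (down-oddʳ (≤∧≢⇒< a<b (even≢odd ea+1 ob)) ob)

    two-points⇒≡ : ∀ {a b} → a ∈ I → b ∈ I → a ≢ b → I ≡ X
    two-points⇒≡ {a} {b} a∈I b∈I a≢b = ends⇒≡ ends
      where
      ends : Ends
      ends with <-cmp (toℕ a) (toℕ b)
      ... | tri< a<b _ _ = ordered a<b (a , refl , a∈I) (b , refl , b∈I)
      ... | tri≈ _ a≡b _ = ⊥-elim (a≢b (toℕ-injective a≡b))
      ... | tri> _ _ b<a = ordered b<a (b , refl , b∈I) (a , refl , a∈I)

⊥-or-singleton-or-pair : ∀ {m} (S : Subset m) →
  S ≡ ⊥ ⊎ (∃ λ y → S ≡ ⁅ y ⁆) ⊎ (Σ (Fin m) λ a → Σ (Fin m) λ b → a ∈ S × b ∈ S × a ≢ b)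
⊥-or-singleton-or-pair [] = inj₁ refl
⊥-or-singleton-or-pair (outside ∷ S) with ⊥-or-singleton-or-pair S
... | inj₁ S≡⊥ = inj₁ (cong (outside ∷_) S≡⊥)
... | inj₂ (inj₁ (y , S≡⁅y⁆)) = inj₂ (inj₁ (suc y , cong (outside ∷_) S≡⁅y⁆))
... | inj₂ (inj₂ (a , b , a∈S , b∈S , a≢b)) =
  inj₂ (inj₂ (suc a , suc b , there a∈S , there b∈S , a≢b ∘′ Data.Fin.Properties.suc-injective))
⊥-or-singleton-or-pair (inside ∷ S) with ⊥-or-singleton-or-pair S
... | inj₁ S≡⊥ = inj₂ (inj₁ (zero , cong (inside ∷_) S≡⊥))
... | inj₂ (inj₁ (y , S≡⁅y⁆)) =
  inj₂ (inj₂ (zero , suc y , here , there (subst (y ∈_) (sym S≡⁅y⁆) (x∈⁅x⁆ y)) , λ ()))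
... | inj₂ (inj₂ (a , _ , a∈S , _ , _)) = inj₂ (inj₂ (zero , suc a , here , there a∈S , λ ()))

indecomposable-by-pairs : ∀ {m} {arc : Arcs m} {X : Subset m} →
  (∀ {I} → IsInterval arc X I → ∀ {a b} → a ∈ I → b ∈ I → a ≢ b → I ≡ X) → IndecomposableOn arc X
indecomposable-by-pairs pair⇒≡ I iv with ⊥-or-singleton-or-pair I
... | inj₁ I≡⊥ = inj₁ I≡⊥
... | inj₂ (inj₁ singleton) = inj₂ (inj₁ singleton)
... | inj₂ (inj₂ (a , b , a∈I , b∈I , a≢b)) = inj₂ (inj₂ (pair⇒≡ iv a∈I b∈I a≢b))

module IndecomposabilityE {n k : ℕ} (1≤k : 1 ≤ k) (k+2≤n : k + 2 ≤ n)
  {X : Subset (2 * n + 1)} (covers : ContainsAllBut n (2 * k + 1) X)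
  {I : Subset (2 * n + 1)} (iv : IsInterval (onFin n (Eℕ n k)) X I) where
  open Indecomposability 1≤k k+2≤n (E-evenReversal n k) covers iv public

  private
    flips-across : ∀ {u v} → u < 2 * k + 1 → 2 * k + 1 < v → flipsE k u v ≡ true
    flips-across p q rewrite <⇒<ᵇ≡true p | <⇒<ᵇ≡true q = refl

    flips-P : ∀ {u v} → v < 2 * k + 1 → flipsE k u v ≡ false
    flips-P {u} q rewrite ≥⇒<ᵇ≡false (<⇒≤ q) = ∧-zeroʳ (u <ᵇ 2 * k + 1)

    flips-Q : ∀ {u v} → 2 * k + 1 < u → flipsE k u v ≡ false
    flips-Q p rewrite ≥⇒<ᵇ≡false (<⇒≤ p) = refl

    across⇒ends : ∀ {p q} → isEven p ≡ true → isEven q ≡ true → p < 2 * k + 1 → 2 * k + 1 < q →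
      p ∈ℕ I → q ∈ℕ I → Ends
    across⇒ends {p} {q} ep eq p<m m<q p∈I q∈I = 0∈I , 2n∈I
      where
      0∈I : 0 ∈ℕ I
      0∈I with p ≟ 0
      ... | yes p≡0 = subst (_∈ℕ I) p≡0 p∈I
      ... | no p≢0 = separator-∈ q∈I p∈I 0∈X
        (down-even (≤-<-trans z≤n (<-trans p<m m<q)) refl eq (flips-across 0<2k+1 m<q))
        (down-even (≤∧≢⇒< z≤n (≢-sym p≢0)) refl ep (flips-P p<m))
      2n∈I : 2 * n ∈ℕ I
      2n∈I with q ≟ 2 * n
      ... | yes q≡2n = subst (_∈ℕ I) q≡2n q∈I
      ... | no q≢2n = separator-∈ q∈I p∈I 2n∈X
        (up-even q<2n eq isEven-2n (flips-Q {v = 2 * n} m<q))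
        (up-even (<-trans (<-trans p<m m<q) q<2n) ep isEven-2n (flips-across p<m 2k+1<2n))
        where
        q<2n : q < 2 * n
        q<2n = ≤∧≢⇒< (label≤ {n} q∈I) q≢2n

  mixed : MixedPairsReachEnds
  mixed {o} {e} oo ee o∈I e∈I with <-cmp e (2 * k + 1)
  ... | tri< e<m _ _ = across⇒ends ee isEven-2n e<m 2k+1<2n e∈I
    (separator-∈ o∈I e∈I 2n∈X (up-oddˡ (odd-label<2n oo o∈I) oo)
      (up-even (<-trans e<m 2k+1<2n) ee isEven-2n (flips-across e<m 2k+1<2n)))
  ... | tri≈ _ e≡m _ = ⊥-elim (even≢odd ee isEven-2k+1 e≡m)
  ... | tri> _ _ m<e = across⇒ends refl ee 0<2k+1 m<e
    (separator-∈ e∈I o∈I 0∈X (down-even (<-trans 0<2k+1 m<e) refl ee (flips-across 0<2k+1 m<e))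
      (down-oddʳ (odd⇒0< {o} oo) oo))
    e∈I

  straddling : StraddlingPairReachesEnds
  straddling = across⇒ends isEven-2k isEven-2k+2 2k<2k+1 (n<1+n _)

E-indecomposableOn : ∀ {n k} → 1 ≤ k → k + 2 ≤ n → ∀ {X} → ContainsAllBut n (2 * k + 1) X →
  IndecomposableOn (onFin n (Eℕ n k)) X
E-indecomposableOn 1≤k k+2≤n covers = indecomposable-by-pairs λ iv →
  let open IndecomposabilityE 1≤k k+2≤n covers iv in two-points⇒≡ mixed straddling

module IndecomposabilityF {n k : ℕ} (1≤k : 1 ≤ k) (k+2≤n : k + 2 ≤ n)
  {X : Subset (2 * n + 1)} (covers : ContainsAllBut n (2 * k + 1) X)
  {I : Subset (2 * n + 1)} (iv : IsInterval (onFin n (Fℕ n k)) X I) where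
  open Indecomposability 1≤k k+2≤n (F-evenReversal n k) covers iv public

  mixed : MixedPairsReachEnds
  mixed {o} {e} oo ee o∈I e∈I = 0∈I , 2n∈I
    where
    0∈I : 0 ∈ℕ I
    0∈I with e ≟ 0
    ... | yes e≡0 = subst (_∈ℕ I) e≡0 e∈I
    ... | no e≢0 = separator-∈ e∈I o∈I 0∈X
      (down-even (≤∧≢⇒< z≤n (≢-sym e≢0)) refl ee (<⇒<ᵇ≡true 0<2k+1))
      (down-oddʳ (odd⇒0< {o} oo) oo)
    2n∈I : 2 * n ∈ℕ I
    2n∈I = separator-∈ o∈I 0∈I 2n∈X (up-oddˡ (odd-label<2n oo o∈I) oo)
      (up-even (≤-<-trans z≤n 2k<2n) refl isEven-2n (<⇒<ᵇ≡true 0<2k+1))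

  straddling : StraddlingPairReachesEnds
  straddling 2k∈I 2k+2∈I = mixed isEven-penult isEven-2k penult∈I 2k∈I
    where
    2n∈I : 2 * n ∈ℕ I
    2n∈I = separator-∈ 2k+2∈I 2k∈I 2n∈X
      (up-even 2k+2<2n isEven-2k+2 isEven-2n (≥⇒<ᵇ≡false (n≤1+n (2 * k + 1))))
      (up-even 2k<2n isEven-2k isEven-2n (<⇒<ᵇ≡true 2k<2k+1))
    penult∈I : penult ∈ℕ I
    penult∈I = separator-∈ 2k∈I 2n∈I penult∈X
      (up-oddʳ (<-trans 2k<2k+1 2k+1<penult) isEven-penult) (down-oddˡ penult<2n isEven-penult)

F-indecomposableOn : ∀ {n k} → 1 ≤ k → k + 2 ≤ n → ∀ {X} → ContainsAllBut n (2 * k + 1) X →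
  IndecomposableOn (onFin n (Fℕ n k)) X
F-indecomposableOn 1≤k k+2≤n covers = indecomposable-by-pairs λ iv →
  let open IndecomposabilityF 1≤k k+2≤n covers iv in two-points⇒≡ mixed straddling

module IndecomposabilityG {n k : ℕ} (1≤k : 1 ≤ k) (k+2≤n : k + 2 ≤ n)
  {X : Subset (2 * n + 1)} (covers : ContainsAllBut n (2 * k + 1) X)
  {I : Subset (2 * n + 1)} (iv : IsInterval (onFin n (Gℕ n k)) X I) where
  open Indecomposability 1≤k k+2≤n (G-evenReversal n k) covers iv public

  private
    flips-to-2n : ∀ u → flipsG n k u (2 * n) ≡ true
    flips-to-2n u rewrite ≡ᵇ-refl (2 * n) = ∨-zeroʳ _

  mixed : MixedPairsReachEnds
  mixed {o} {e} oo ee o∈I e∈I = 0∈I , 2n∈I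
    where
    2n∈I : 2 * n ∈ℕ I
    2n∈I with e ≟ 2 * n
    ... | yes e≡2n = subst (_∈ℕ I) e≡2n e∈I
    ... | no e≢2n = separator-∈ o∈I e∈I 2n∈X (up-oddˡ (odd-label<2n oo o∈I) oo)
      (up-even (≤∧≢⇒< (label≤ {n} e∈I) e≢2n) ee isEven-2n (flips-to-2n e))
    0∈I : 0 ∈ℕ I
    0∈I = separator-∈ 2n∈I o∈I 0∈X
      (down-even (≤-<-trans z≤n 2k<2n) refl isEven-2n (flips-to-2n 0)) (down-oddʳ (odd⇒0< {o} oo) oo)

  straddling : StraddlingPairReachesEnds
  straddling 2k∈I 2k+2∈I = mixed {1} refl refl 1∈I 0∈I
    where
    flips-0-2k+2 : flipsG n k 0 (suc (2 * k + 1)) ≡ false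
    flips-0-2k+2 rewrite ≥⇒<ᵇ≡false (n≤1+n (2 * k + 1)) | ≢⇒≡ᵇ≡false (<⇒≢ 2k+2<2n) = refl
    0∈I : 0 ∈ℕ I
    0∈I = separator-∈ 2k∈I 2k+2∈I 0∈X
      (down-even 0<2k refl isEven-2k (cong (_∨ (2 * k ≡ᵇ 2 * n)) (<⇒<ᵇ≡true 2k<2k+1)))
      (down-even (s≤s z≤n) refl isEven-2k+2 flips-0-2k+2)
    1∈I : 1 ∈ℕ I
    1∈I = separator-∈ 0∈I 2k+2∈I 1∈X (up-oddʳ (s≤s z≤n) refl) (down-oddˡ (<-trans 1<2k+1 (n<1+n _)) refl)

G-indecomposableOn : ∀ {n k} → 1 ≤ k → k + 2 ≤ n → ∀ {X} → ContainsAllBut n (2 * k + 1) X →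
  IndecomposableOn (onFin n (Gℕ n k)) X
G-indecomposableOn 1≤k k+2≤n covers = indecomposable-by-pairs λ iv →
  let open IndecomposabilityG 1≤k k+2≤n covers iv in two-points⇒≡ mixed straddling

module IndecomposabilityH {n k : ℕ} (1≤k : 1 ≤ k) (k+2≤n : k + 2 ≤ n)
  {X : Subset (2 * n + 1)} (covers : ContainsAllBut n (2 * k + 1) X)
  {I : Subset (2 * n + 1)} (iv : IsInterval (onFin n (Hℕ n k)) X I) where
  open Bounds 1≤k k+2≤n using (2k+1<2n)
  open Indecomposability 1≤k k+2≤n (H-evenReversal n k (<⇒≤ 2k+1<2n)) covers iv public

  private
    flips-to-2k : ∀ u → flipsH n k u (2 * k) ≡ true
    flips-to-2k u rewrite ≡ᵇ-refl (2 * k) = refl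

    flips-to-2n : ∀ {u} → 2 * k ≤ u → flipsH n k u (2 * n) ≡ true
    flips-to-2n 2k≤u rewrite ≢⇒≡ᵇ≡false (>⇒≢ 2k<2n) | ≡ᵇ-refl (2 * n) | ≥⇒<ᵇ≡false 2k≤u = refl

    2k∈X : 2 * k ∈ℕ X
    2k∈X = covers (<⇒≤ 2k<2n) (<⇒≢ 2k<2k+1)

    odd-and-2k⇒ends : ∀ {o} → isEven o ≡ false → o ∈ℕ I → 2 * k ∈ℕ I → Ends
    odd-and-2k⇒ends {o} oo o∈I 2k∈I =
        separator-∈ 2k∈I o∈I 0∈X (down-even 0<2k refl isEven-2k (flips-to-2k 0))
          (down-oddʳ (odd⇒0< {o} oo) oo)
      , separator-∈ o∈I 2k∈I 2n∈X (up-oddˡ (odd-label<2n oo o∈I) oo)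
          (up-even 2k<2n isEven-2k isEven-2n (flips-to-2n ≤-refl))

    odd-and-2n⇒ends : ∀ {o} → isEven o ≡ false → o ∈ℕ I → 2 * n ∈ℕ I → Ends
    odd-and-2n⇒ends {o} oo o∈I 2n∈I = odd-and-2k⇒ends isEven-penult penult∈I 2k∈I
      where
      penult∈I : penult ∈ℕ I
      penult∈I with o ≟ penult
      ... | yes o≡penult = subst (_∈ℕ I) o≡penult o∈I
      ... | no o≢penult = separator-∈ o∈I 2n∈I penult∈X
        (up-oddˡ (≤∧≢⇒< (≤-pred (subst (o <_) (sym suc-penult) (odd-label<2n oo o∈I))) o≢penult) oo)
        (down-oddˡ penult<2n isEven-penult)
      2k∈I : 2 * k ∈ℕ I
      2k∈I = separator-∈ 2n∈I penult∈I 2k∈X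
        (down-even 2k<2n isEven-2k isEven-2n (flips-to-2n ≤-refl))
        (down-oddʳ (<-trans 2k<2k+1 2k+1<penult) isEven-penult)

    2k-1 : ℕ
    2k-1 = pred (2 * k)

    suc-2k-1 : suc 2k-1 ≡ 2 * k
    suc-2k-1 = suc-pred (2 * k) {{>-nonZero 0<2k}}

    isEven-2k-1 : isEven 2k-1 ≡ false
    isEven-2k-1 = parity-pred {2k-1} (trans (cong isEven suc-2k-1) isEven-2k)

    2k-1<2k : 2k-1 < 2 * k
    2k-1<2k = subst (2k-1 <_) suc-2k-1 ≤-refl

    -- An odd vertex of I below 2k: o itself, or else 2k-1, which separates e from o.
    odd-below-2k : ∀ {o e} → isEven o ≡ false → isEven e ≡ true → e < 2 * k → o ∈ℕ I → e ∈ℕ I →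
      Σ ℕ λ o′ → isEven o′ ≡ false × o′ < 2 * k × o′ ∈ℕ I
    odd-below-2k {o} {e} oo ee e<2k o∈I e∈I with <-cmp o (2 * k)
    ... | tri< o<2k _ _ = o , oo , o<2k , o∈I
    ... | tri≈ _ o≡2k _ = ⊥-elim (odd≢even oo isEven-2k o≡2k)
    ... | tri> _ _ 2k<o = 2k-1 , isEven-2k-1 , 2k-1<2k , separator-∈ e∈I o∈I
      (covers (<⇒≤ (<-trans 2k-1<2k 2k<2n)) (<⇒≢ (<-trans 2k-1<2k 2k<2k+1)))
      (up-oddʳ (≤∧≢⇒< (≤-pred (subst (e <_) (sym suc-2k-1) e<2k)) (even≢odd ee isEven-2k-1)) isEven-2k-1)
      (down-oddˡ (<-trans 2k-1<2k 2k<o) isEven-2k-1)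

  mixed : MixedPairsReachEnds
  mixed {o} {e} oo ee o∈I e∈I with <-cmp e (2 * k)
  ... | tri≈ _ e≡2k _ = odd-and-2k⇒ends oo o∈I (subst (_∈ℕ I) e≡2k e∈I)
  ... | tri< e<2k _ _ with odd-below-2k oo ee e<2k o∈I e∈I
  ...   | o′ , oo′ , o′<2k , o′∈I = odd-and-2k⇒ends oo′ o′∈I
          (separator-∈ o′∈I e∈I 2k∈X (up-oddˡ o′<2k oo′) (up-even e<2k ee isEven-2k (flips-to-2k e)))
  mixed {o} {e} oo ee o∈I e∈I | tri> _ _ 2k<e with e ≟ 2 * n
  ...   | yes e≡2n = odd-and-2n⇒ends oo o∈I (subst (_∈ℕ I) e≡2n e∈I)
  ...   | no e≢2n = odd-and-2n⇒ends oo o∈I (separator-∈ o∈I e∈I 2n∈X (up-oddˡ (odd-label<2n oo o∈I) oo)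
          (up-even (≤∧≢⇒< (label≤ {n} e∈I) e≢2n) ee isEven-2n (flips-to-2n (<⇒≤ 2k<e))))

  straddling : StraddlingPairReachesEnds
  straddling 2k∈I 2k+2∈I = mixed {1} refl refl 1∈I 0∈I
    where
    flips-0-2k+2 : flipsH n k 0 (suc (2 * k + 1)) ≡ false
    flips-0-2k+2 rewrite ≢⇒≡ᵇ≡false (>⇒≢ (<-trans 2k<2k+1 (n<1+n (2 * k + 1))))
                       | ≢⇒≡ᵇ≡false (<⇒≢ 2k+2<2n) = refl
    0∈I : 0 ∈ℕ I
    0∈I = separator-∈ 2k∈I 2k+2∈I 0∈X (down-even 0<2k refl isEven-2k (flips-to-2k 0))
      (down-even (s≤s z≤n) refl isEven-2k+2 flips-0-2k+2)
    1∈I : 1 ∈ℕ I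
    1∈I = separator-∈ 0∈I 2k+2∈I 1∈X (up-oddʳ (s≤s z≤n) refl) (down-oddˡ (<-trans 1<2k+1 (n<1+n _)) refl)

H-indecomposableOn : ∀ {n k} → 1 ≤ k → k + 2 ≤ n → ∀ {X} → ContainsAllBut n (2 * k + 1) X →
  IndecomposableOn (onFin n (Hℕ n k)) X
H-indecomposableOn 1≤k k+2≤n covers = indecomposable-by-pairs λ iv →
  let open IndecomposabilityH 1≤k k+2≤n covers iv in two-points⇒≡ mixed straddling

-- Criticality of the vertices other than 2k+1

subsetOf : ∀ {m} → (ℕ → Bool) → Subset m
subsetOf p = tabulate (p ∘′ toℕ)

∈-subsetOf : ∀ {m} p {x : Fin m} → p (toℕ x) ≡ true → x ∈ subsetOf p
∈-subsetOf p {x} px = lookup⇒[]= x (subsetOf p) (trans (lookup∘tabulate (p ∘′ toℕ) x) px)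

∈-subsetOf⁻ : ∀ {m} p {x : Fin m} → x ∈ subsetOf p → p (toℕ x) ≡ true
∈-subsetOf⁻ p {x} x∈ = trans (sym (lookup∘tabulate (p ∘′ toℕ) x)) ([]=⇒lookup x∈)

∉-subsetOf⁻ : ∀ {m} p {x : Fin m} → x ∉ subsetOf p → p (toℕ x) ≡ false
∉-subsetOf⁻ p {x} x∉ with p (toℕ x) in px
... | true = ⊥-elim (x∉ (∈-subsetOf p px))
... | false = refl

x∈p─q⇒x∉q : ∀ {m} {x : Fin m} (p q : Subset m) → x ∈ p ─ q → x ∉ q
x∈p─q⇒x∉q (_ ∷ p) (outside ∷ q) (there x∈) (there x∈q) = x∈p─q⇒x∉q p q x∈ x∈q
x∈p─q⇒x∉q (_ ∷ p) (inside ∷ q) (there x∈) (there x∈q) = x∈p─q⇒x∉q p q x∈ x∈q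

x∈p-y⇒x≢y : ∀ {m} {x y : Fin m} {p : Subset m} → x ∈ p - y → x ≢ y
x∈p-y⇒x≢y {x = x} {p = p} x∈ refl = x∈p─q⇒x∉q p ⁅ x ⁆ x∈ (x∈⁅x⁆ x)

nontrivial : ∀ {m} {X I : Subset m} {a b c} → a ∈ I → b ∈ I → a ≢ b → c ∈ X → c ∉ I → ¬ IsTrivial X I
nontrivial a∈I _ _ _ _ (inj₁ refl) = ∉⊥ a∈I
nontrivial a∈I b∈I a≢b _ _ (inj₂ (inj₁ (y , refl))) = a≢b (trans (x∈⁅y⁆⇒x≡y y a∈I) (sym (x∈⁅y⁆⇒x≡y y b∈I)))
nontrivial _ _ _ c∈X c∉I (inj₂ (inj₂ refl)) = c∉I c∈X

module Vertices (n : ℕ) where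

  vertex : ∀ {u} → u ≤ 2 * n → Fin (2 * n + 1)
  vertex u≤2n = fromℕ< (≤-<-trans u≤2n (m<m+n (2 * n) (s≤s z≤n)))

  toℕ-vertex : ∀ {u} (u≤2n : u ≤ 2 * n) → toℕ (vertex u≤2n) ≡ u
  toℕ-vertex _ = toℕ-fromℕ< _

  toℕ≤2n : (x : Fin (2 * n + 1)) → toℕ x ≤ 2 * n
  toℕ≤2n x = <2n+1⇒≤2n {n = n} (toℕ<n x)

  data Position (u : ℕ) : Set where
    first : u ≡ 0 → Position u
    last : u ≡ 2 * n → Position u
    inner : ∀ {w′} → u ≡ suc w′ → suc (suc w′) ≤ 2 * n → Position u

  position : ∀ {u} → u ≤ 2 * n → Position u
  position {zero} _ = first refl
  position {suc w′} u≤2n with suc w′ ≟ 2 * n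
  ... | yes u≡2n = last u≡2n
  ... | no u≢2n = inner refl (≤∧≢⇒< u≤2n u≢2n)

module Criticality (n : ℕ) (r : ℕ → ℕ → Bool) where
  open Vertices n public

  critical-by-interval : ∀ w (p : ℕ → Bool) →
    (∀ {u} → p u ≡ true → u ≢ toℕ w) →
    (∀ {a b x} → a ≤ 2 * n → b ≤ 2 * n → x ≤ 2 * n →
      p a ≡ true → p b ≡ true → x ≢ toℕ w → p x ≡ false → r a x ≡ r b x) →
    ∀ {a₁ a₂ c} → a₁ ≤ 2 * n → a₂ ≤ 2 * n → c ≤ 2 * n → a₁ ≢ a₂ →
    p a₁ ≡ true → p a₂ ≡ true → c ≢ toℕ w → p c ≡ false →
    Critical (onFin n r) w
  critical-by-interval w p avoids-w interval a₁≤ a₂≤ c≤ a₁≢a₂ pa₁ pa₂ c≢w pc indecomposable =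
    nontrivial (vertex-∈ a₁≤ pa₁) (vertex-∈ a₂≤ pa₂) (a₁≢a₂ ∘′ vertex-injective a₁≤ a₂≤)
      (x∈p∧x≢y⇒x∈p-y ∈⊤ (c≢w ∘′ trans (sym (toℕ-vertex c≤)) ∘′ cong toℕ)) c∉
      (indecomposable (subsetOf p) iv)
    where
    iv : IsInterval (onFin n r) (⊤ - w) (subsetOf p)
    iv = (λ {x} x∈ → x∈p∧x≢y⇒x∈p-y ∈⊤ (avoids-w (∈-subsetOf⁻ p x∈) ∘′ cong toℕ))
       , λ a b x a∈ b∈ x∈X x∉ → interval (toℕ≤2n a) (toℕ≤2n b) (toℕ≤2n x)
           (∈-subsetOf⁻ p a∈) (∈-subsetOf⁻ p b∈) (x∈p-y⇒x≢y x∈X ∘′ toℕ-injective) (∉-subsetOf⁻ p x∉)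
    vertex-∈ : ∀ {u} (u≤ : u ≤ 2 * n) → p u ≡ true → vertex u≤ ∈ subsetOf p
    vertex-∈ u≤ pu = ∈-subsetOf p (trans (cong p (toℕ-vertex u≤)) pu)
    vertex-injective : ∀ {u v} (u≤ : u ≤ 2 * n) (v≤ : v ≤ 2 * n) → vertex u≤ ≡ vertex v≤ → u ≡ v
    vertex-injective u≤ v≤ e = trans (sym (toℕ-vertex u≤)) (trans (cong toℕ e) (toℕ-vertex v≤))
    c∉ : vertex c≤ ∉ subsetOf p
    c∉ c∈ = true≢false (trans (sym (∈-subsetOf⁻ p c∈)) (trans (cong p (toℕ-vertex c≤)) pc))

  critical-by-twins : ∀ w {a₁ a₂ c} → a₁ ≤ 2 * n → a₂ ≤ 2 * n → c ≤ 2 * n → a₁ ≢ a₂ →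
    a₁ ≢ toℕ w → a₂ ≢ toℕ w → c ≢ toℕ w → c ≢ a₁ → c ≢ a₂ →
    (∀ {x} → x ≤ 2 * n → x ≢ a₁ → x ≢ a₂ → x ≢ toℕ w → r a₁ x ≡ r a₂ x) →
    Critical (onFin n r) w
  critical-by-twins w {a₁} {a₂} a₁≤ a₂≤ c≤ a₁≢a₂ a₁≢w a₂≢w c≢w c≢a₁ c≢a₂ twins =
    critical-by-interval w pair avoids-w interval a₁≤ a₂≤ c≤ a₁≢a₂ pair-a₁ pair-a₂ c≢w
      (cong₂ _∨_ (≢⇒≡ᵇ≡false c≢a₁) (≢⇒≡ᵇ≡false c≢a₂))
    where
    pair : ℕ → Bool
    pair u = (u ≡ᵇ a₁) ∨ (u ≡ᵇ a₂)
    pair-a₁ : pair a₁ ≡ true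
    pair-a₁ = cong (_∨ (a₁ ≡ᵇ a₂)) (≡ᵇ-refl a₁)
    pair-a₂ : pair a₂ ≡ true
    pair-a₂ = trans (cong ((a₂ ≡ᵇ a₁) ∨_) (≡ᵇ-refl a₂)) (∨-zeroʳ _)
    in-pair : ∀ {u} → pair u ≡ true → u ≡ a₁ ⊎ u ≡ a₂
    in-pair pu with ∨-true pu
    ... | inj₁ e = inj₁ (≡ᵇ≡true⇒≡ e)
    ... | inj₂ e = inj₂ (≡ᵇ≡true⇒≡ e)
    not-in-pair : ∀ {u} → pair u ≡ false → u ≢ a₁ × u ≢ a₂
    not-in-pair pu = (λ u≡a₁ → true≢false (trans (sym (trans (cong pair u≡a₁) pair-a₁)) pu))
                   , (λ u≡a₂ → true≢false (trans (sym (trans (cong pair u≡a₂) pair-a₂)) pu))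
    avoids-w : ∀ {u} → pair u ≡ true → u ≢ toℕ w
    avoids-w {u} pu with in-pair {u} pu
    ... | inj₁ refl = a₁≢w
    ... | inj₂ refl = a₂≢w
    like-a₁ : ∀ {a x} → pair a ≡ true → x ≤ 2 * n → x ≢ a₁ → x ≢ a₂ → x ≢ toℕ w → r a x ≡ r a₁ x
    like-a₁ {a} pa x≤ x≢a₁ x≢a₂ x≢w with in-pair {a} pa
    ... | inj₁ refl = refl
    ... | inj₂ refl = sym (twins x≤ x≢a₁ x≢a₂ x≢w)
    interval : ∀ {a b x} → a ≤ 2 * n → b ≤ 2 * n → x ≤ 2 * n →
      pair a ≡ true → pair b ≡ true → x ≢ toℕ w → pair x ≡ false → r a x ≡ r b x
    interval {a} {b} {x} _ _ x≤ pa pb x≢w px with not-in-pair {x} px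
    ... | x≢a₁ , x≢a₂ = trans (like-a₁ {a} pa x≤ x≢a₁ x≢a₂ x≢w) (sym (like-a₁ {b} pb x≤ x≢a₁ x≢a₂ x≢w))

module CriticalityOf {n k : ℕ} (1≤k : 1 ≤ k) (k+2≤n : k + 2 ≤ n)
  {R r : ℕ → ℕ → Bool} (er : EvenReversal R r) where
  open Bounds 1≤k k+2≤n public
  open EvenReversal er public
  open Criticality n r public

  critical-0 : ∀ w → toℕ w ≡ 0 → Critical (onFin n r) w
  critical-0 w w≡0 = critical-by-interval w (1 <ᵇ_) avoids-w interval {2} {3} {1}
    (<⇒≤ 2<2n) 2<2n (≤-trans (s≤s z≤n) 2<2n) (λ ()) refl refl (λ 1≡w → 1+n≢0 (trans 1≡w w≡0)) refl
    where
    2<2n : 2 < 2 * n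
    2<2n = ≤-<-trans 1<penult penult<2n
    avoids-w : ∀ {u} → (1 <ᵇ u) ≡ true → u ≢ toℕ w
    avoids-w pu u≡w = n≮0 (subst (1 <_) (trans u≡w w≡0) (<ᵇ≡true⇒< pu))
    interval : ∀ {a b x} → a ≤ 2 * n → b ≤ 2 * n → x ≤ 2 * n →
      (1 <ᵇ a) ≡ true → (1 <ᵇ b) ≡ true → x ≢ toℕ w → (1 <ᵇ x) ≡ false → r a x ≡ r b x
    interval {a} {b} {x} _ _ _ pa pb x≢w px = subst (λ y → r a y ≡ r b y) (sym x≡1)
      (trans (down-oddˡ (<ᵇ≡true⇒< pa) refl) (sym (down-oddˡ (<ᵇ≡true⇒< pb) refl)))
      where
      x≡1 : x ≡ 1
      x≡1 = ≤-antisym (<ᵇ≡false⇒≥ px) (≤∧≢⇒< z≤n (λ 0≡x → x≢w (trans (sym 0≡x) (sym w≡0))))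

  critical-2n : ∀ w → toℕ w ≡ 2 * n → Critical (onFin n r) w
  critical-2n w w≡2n = critical-by-interval w (_<ᵇ penult) avoids-w interval {0} {1} {penult}
    z≤n (<⇒≤ (<-trans 1<penult penult<2n)) (<⇒≤ penult<2n) (λ ())
    (<⇒<ᵇ≡true (<-trans (s≤s z≤n) 1<penult)) (<⇒<ᵇ≡true 1<penult)
    (λ penult≡w → <⇒≢ penult<2n (trans penult≡w w≡2n)) (≥⇒<ᵇ≡false (≤-refl {penult}))
    where
    avoids-w : ∀ {u} → (u <ᵇ penult) ≡ true → u ≢ toℕ w
    avoids-w pu u≡w = <⇒≢ (<-trans (<ᵇ≡true⇒< pu) penult<2n) (trans u≡w w≡2n)
    interval : ∀ {a b x} → a ≤ 2 * n → b ≤ 2 * n → x ≤ 2 * n →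
      (a <ᵇ penult) ≡ true → (b <ᵇ penult) ≡ true → x ≢ toℕ w → (x <ᵇ penult) ≡ false → r a x ≡ r b x
    interval {a} {b} {x} _ _ x≤2n pa pb x≢w px = subst (λ y → r a y ≡ r b y) (sym x≡penult)
      (trans (up-oddʳ (<ᵇ≡true⇒< pa) isEven-penult) (sym (up-oddʳ (<ᵇ≡true⇒< pb) isEven-penult)))
      where
      x≡penult : x ≡ penult
      x≡penult = ≤-antisym
        (≤-pred (subst (x <_) (sym suc-penult) (≤∧≢⇒< x≤2n (λ x≡2n → x≢w (trans x≡2n (sym w≡2n))))))
        (<ᵇ≡false⇒≥ px)

  antepenult : ℕ
  antepenult = pred penult

  suc-antepenult : suc antepenult ≡ penult
  suc-antepenult = suc-pred penult {{>-nonZero (<-trans (s≤s z≤n) 1<penult)}}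

  antepenult<penult : antepenult < penult
  antepenult<penult = subst (antepenult <_) suc-antepenult ≤-refl

  isEven-antepenult : isEven antepenult ≡ true
  isEven-antepenult = parity-pred {antepenult} (trans (cong isEven suc-antepenult) isEven-penult)

  2k+1<antepenult : 2 * k + 1 < antepenult
  2k+1<antepenult = ≤∧≢⇒< (≤-pred (subst (2 * k + 1 <_) (sym suc-antepenult) 2k+1<penult))
                          (odd≢even isEven-2k+1 isEven-antepenult)

  -- In T - (2n-1) every vertex dominates 2n-2, so all the others form an interval.
  critical-penult : (∀ {a} → a < antepenult → R a antepenult ≡ false) → R antepenult (2 * n) ≡ true →
    ∀ w → toℕ w ≡ penult → Critical (onFin n r) w
  critical-penult below above w w≡penult =
    critical-by-interval w p avoids-w interval {0} {1} {antepenult}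
      z≤n (<⇒≤ 1<2n) (<⇒≤ antepenult<2n) (λ ())
      (cong (_∨ (0 ≡ᵇ 2 * n)) (<⇒<ᵇ≡true (<-trans (s≤s z≤n) 1<antepenult)))
      (cong (_∨ (1 ≡ᵇ 2 * n)) (<⇒<ᵇ≡true 1<antepenult))
      (λ e → <⇒≢ antepenult<penult (trans e w≡penult))
      (cong₂ _∨_ (≥⇒<ᵇ≡false (≤-refl {antepenult})) (≢⇒≡ᵇ≡false (<⇒≢ antepenult<2n)))
    where
    p : ℕ → Bool
    p u = (u <ᵇ antepenult) ∨ (u ≡ᵇ 2 * n)
    1<antepenult : 1 < antepenult
    1<antepenult = <-trans 1<2k+1 2k+1<antepenult
    antepenult<2n : antepenult < 2 * n
    antepenult<2n = <-trans antepenult<penult penult<2n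
    1<2n : 1 < 2 * n
    1<2n = <-trans 1<antepenult antepenult<2n
    avoids-w : ∀ {u} → p u ≡ true → u ≢ toℕ w
    avoids-w {u} pu u≡w with ∨-true {u <ᵇ antepenult} pu
    ... | inj₁ u<antepenult = <⇒≢ (<-trans (<ᵇ≡true⇒< u<antepenult) antepenult<penult) (trans u≡w w≡penult)
    ... | inj₂ u≡2n = <⇒≢ penult<2n (trans (sym (trans u≡w w≡penult)) (≡ᵇ≡true⇒≡ u≡2n))
    to-antepenult : ∀ {a} → p a ≡ true → r a antepenult ≡ true
    to-antepenult {a} pa with ∨-true {a <ᵇ antepenult} pa
    ... | inj₁ a<antepenult = trans (upward (<ᵇ≡true⇒< a<antepenult))
        (cong not (evenPair-unrelated R a antepenult (below (<ᵇ≡true⇒< a<antepenult))))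
    ... | inj₂ a≡2n = subst (λ y → r y antepenult ≡ true) (sym (≡ᵇ≡true⇒≡ a≡2n))
        (down-even antepenult<2n isEven-antepenult isEven-2n above)
    interval : ∀ {a b x} → a ≤ 2 * n → b ≤ 2 * n → x ≤ 2 * n →
      p a ≡ true → p b ≡ true → x ≢ toℕ w → p x ≡ false → r a x ≡ r b x
    interval {a} {b} {x} _ _ x≤2n pa pb x≢w px with ∨-false {x <ᵇ antepenult} px
    ... | x≮antepenult , x≢ᵇ2n = subst (λ y → r a y ≡ r b y) (sym x≡antepenult)
        (trans (to-antepenult {a} pa) (sym (to-antepenult {b} pb)))
      where
      x<2n : x < 2 * n
      x<2n = ≤∧≢⇒< x≤2n (≡ᵇ≡false⇒≢ x≢ᵇ2n)
      x<penult : x < penult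
      x<penult = ≤∧≢⇒< (≤-pred (subst (x <_) (sym suc-penult) x<2n))
                       (λ x≡penult → x≢w (trans x≡penult (sym w≡penult)))
      x≡antepenult : x ≡ antepenult
      x≡antepenult = ≤-antisym (≤-pred (subst (x <_) (sym suc-antepenult) x<penult)) (<ᵇ≡false⇒≥ x≮antepenult)

  -- Removing w′+1 makes w′ and w′+2 twins, provided R does not tell them apart.
  critical-between : ∀ w {w′} → toℕ w ≡ suc w′ → suc (suc w′) ≤ 2 * n →
    (isEven w′ ≡ true → ∀ {x} → x < w′ → R x w′ ≡ R x (suc (suc w′))) →
    (isEven w′ ≡ true → ∀ {x} → suc (suc w′) < x → R w′ x ≡ R (suc (suc w′)) x) →
    Critical (onFin n r) w
  critical-between w {w′} w≡w′+1 w′+2≤2n below above = by-twins (w′ ≟ 0)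
    where
    w′<w′+2 : w′ < suc (suc w′)
    w′<w′+2 = <-trans (n<1+n w′) (n<1+n (suc w′))
    w′<2n : w′ < 2 * n
    w′<2n = <-≤-trans w′<w′+2 w′+2≤2n
    w′≢w : w′ ≢ toℕ w
    w′≢w e = <⇒≢ (n<1+n w′) (trans e w≡w′+1)
    w′+2≢w : suc (suc w′) ≢ toℕ w
    w′+2≢w e = >⇒≢ (n<1+n (suc w′)) (trans e w≡w′+1)
    2<2n : 2 < 2 * n
    2<2n = ≤-<-trans 1<penult penult<2n
    twins : ∀ {x} → x ≤ 2 * n → x ≢ w′ → x ≢ suc (suc w′) → x ≢ toℕ w → r w′ x ≡ r (suc (suc w′)) x
    twins {x} _ x≢w′ x≢w′+2 x≢w with <-cmp x w′ | even-or-odd w′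
    ... | tri≈ _ x≡w′ _ | _ = ⊥-elim (x≢w′ x≡w′)
    ... | tri< x<w′ _ _ | inj₂ ow′ =
      trans (down-oddʳ x<w′ ow′) (sym (down-oddʳ (<-trans x<w′ w′<w′+2) (trans (isEven-+2 w′) ow′)))
    ... | tri< x<w′ _ _ | inj₁ ew′ = begin
      r w′ x                             ≡⟨ downward x<w′ ⟩
      isEven x ∧ (isEven w′ ∧ R x w′)    ≡⟨ cong₂ (λ a b → isEven x ∧ (a ∧ b))
                                                  (sym (isEven-+2 w′)) (below ew′ x<w′) ⟩
      evenPair R x (suc (suc w′))        ≡⟨ downward (<-trans x<w′ w′<w′+2) ⟨
      r (suc (suc w′)) x                 ∎
      where open ≡-Reasoning
    ... | tri> _ _ w′<x | parity = twins-above parity w′+2<x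
      where
      w′+2<x : suc (suc w′) < x
      w′+2<x = ≤∧≢⇒< (≤∧≢⇒< w′<x (λ w′+1≡x → x≢w (trans (sym w′+1≡x) (sym w≡w′+1)))) (≢-sym x≢w′+2)
      twins-above : isEven w′ ≡ true ⊎ isEven w′ ≡ false → suc (suc w′) < x → r w′ x ≡ r (suc (suc w′)) x
      twins-above (inj₂ ow′) w′+2<x =
        trans (up-oddˡ (<-trans w′<w′+2 w′+2<x) ow′) (sym (up-oddˡ w′+2<x (trans (isEven-+2 w′) ow′)))
      twins-above (inj₁ ew′) w′+2<x = begin
        r w′ x                                   ≡⟨ upward (<-trans w′<w′+2 w′+2<x) ⟩
        not (isEven w′ ∧ (isEven x ∧ R w′ x))    ≡⟨ cong₂ (λ a b → not (a ∧ (isEven x ∧ b)))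
                                                        (sym (isEven-+2 w′)) (above ew′ w′+2<x) ⟩
        not (evenPair R (suc (suc w′)) x)        ≡⟨ upward w′+2<x ⟨
        r (suc (suc w′)) x                       ∎
        where open ≡-Reasoning
    by-twins : Dec (w′ ≡ 0) → Critical (onFin n r) w
    by-twins (yes w′≡0) = critical-by-twins w (<⇒≤ w′<2n) w′+2≤2n ≤-refl (<⇒≢ w′<w′+2) w′≢w w′+2≢w
      (λ 2n≡w → <⇒≢ w′+2≤2n (sym (trans 2n≡w w≡w′+1)))
      (>⇒≢ w′<2n)
      (λ 2n≡w′+2 → <⇒≢ 2<2n (sym (trans 2n≡w′+2 (cong (suc ∘′ suc) w′≡0))))
      twins
    by-twins (no w′≢0) = critical-by-twins w (<⇒≤ w′<2n) w′+2≤2n z≤n (<⇒≢ w′<w′+2) w′≢w w′+2≢w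
      (λ 0≡w → 0≢1+n (trans 0≡w w≡w′+1)) (≢-sym w′≢0) 0≢1+n twins

minusOneCritical : ∀ {n k} → 1 ≤ k → k + 2 ≤ n → ∀ {R r} → EvenReversal R r →
  (∀ {X} → ContainsAllBut n (2 * k + 1) X → IndecomposableOn (onFin n r) X) →
  (∀ w → toℕ w ≢ 2 * k + 1 → Critical (onFin n r) w) →
  MinusOneCriticalWithNonCritical (onFin n r) (2 * k + 1)
minusOneCritical {n} {k} 1≤k k+2≤n {r = r} er indecomposableOn critical =
  isTournament n
  , (indecomposableOn everything , 5≤2n+1 , mid , nonCritical mid (toℕ-vertex (<⇒≤ 2k+1<2n)) , unique)
  , nonCritical
  where
  open Bounds 1≤k k+2≤n
  open EvenReversal er using (isTournament)
  open Vertices n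
  everything : ContainsAllBut n (2 * k + 1) ⊤
  everything u≤2n _ = vertex u≤2n , toℕ-vertex u≤2n , ∈⊤
  5≤2n+1 : 5 ≤ 2 * n + 1
  5≤2n+1 = ≤-trans (+-monoˡ-≤ 4 0<2k) (≤-trans 2k+4≤2n (m≤m+n (2 * n) 1))
  mid : Fin (2 * n + 1)
  mid = vertex (<⇒≤ 2k+1<2n)
  nonCritical : ∀ v → toℕ v ≡ 2 * k + 1 → ¬ Critical (onFin n r) v
  nonCritical v v≡2k+1 v-critical = v-critical (indecomposableOn λ {u} u≤2n u≢2k+1 →
    vertex u≤2n , toℕ-vertex u≤2n ,
    x∈p∧x≢y⇒x∈p-y ∈⊤ (λ e → u≢2k+1 (trans (sym (toℕ-vertex u≤2n)) (trans (cong toℕ e) v≡2k+1))))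
  unique : ∀ w → ¬ Critical (onFin n r) w → w ≡ mid
  unique w w-nonCritical with toℕ w ≟ 2 * k + 1
  ... | yes w≡2k+1 = toℕ-injective (trans w≡2k+1 (sym (toℕ-vertex (<⇒≤ 2k+1<2n))))
  ... | no w≢2k+1 = ⊥-elim (w-nonCritical (critical w w≢2k+1))

module _ {n k : ℕ} (1≤k : 1 ≤ k) (k+2≤n : k + 2 ≤ n) where
  open CriticalityOf 1≤k k+2≤n (E-evenReversal n k)

  E-critical : ∀ w → toℕ w ≢ 2 * k + 1 → Critical (onFin n (Eℕ n k)) w
  E-critical w w≢2k+1 with position (toℕ≤2n w)
  ... | first w≡0 = critical-0 w w≡0
  ... | last w≡2n = critical-2n w w≡2n
  ... | inner {w′} w≡w′+1 w′+2≤2n = critical-between w w≡w′+1 w′+2≤2n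
    (λ ew′ {x} _ → cong ((x <ᵇ 2 * k + 1) ∧_) (<ᵇ-+2ʳ (even≢odd ew′ isEven-2k+1) (w≢2k+1 ∘′ trans w≡w′+1)))
    (λ ew′ {x} _ → cong (_∧ (2 * k + 1 <ᵇ x))
      (<ᵇ-+2ˡ (w≢2k+1 ∘′ trans w≡w′+1) (even≢odd (trans (isEven-+2 w′) ew′) isEven-2k+1)))

  E-minusOneCritical : MinusOneCriticalWithNonCritical (E n k) (2 * k + 1)
  E-minusOneCritical =
    minusOneCritical 1≤k k+2≤n (E-evenReversal n k) (E-indecomposableOn 1≤k k+2≤n) E-critical

module _ {n k : ℕ} (1≤k : 1 ≤ k) (k+2≤n : k + 2 ≤ n) where
  open CriticalityOf 1≤k k+2≤n (F-evenReversal n k)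

  F-critical : ∀ w → toℕ w ≢ 2 * k + 1 → Critical (onFin n (Fℕ n k)) w
  F-critical w w≢2k+1 with position (toℕ≤2n w)
  ... | first w≡0 = critical-0 w w≡0
  ... | last w≡2n = critical-2n w w≡2n
  ... | inner {w′} w≡w′+1 w′+2≤2n = critical-between w w≡w′+1 w′+2≤2n
    (λ _ _ → refl)
    (λ ew′ _ → <ᵇ-+2ˡ (w≢2k+1 ∘′ trans w≡w′+1) (even≢odd (trans (isEven-+2 w′) ew′) isEven-2k+1))

  F-minusOneCritical : MinusOneCriticalWithNonCritical (F n k) (2 * k + 1)
  F-minusOneCritical =
    minusOneCritical 1≤k k+2≤n (F-evenReversal n k) (F-indecomposableOn 1≤k k+2≤n) F-critical

module _ {n k : ℕ} (1≤k : 1 ≤ k) (k+2≤n : k + 2 ≤ n) where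
  open CriticalityOf 1≤k k+2≤n (G-evenReversal n k)

  G-critical : ∀ w → toℕ w ≢ 2 * k + 1 → Critical (onFin n (Gℕ n k)) w
  G-critical w w≢2k+1 with position (toℕ≤2n w)
  ... | first w≡0 = critical-0 w w≡0
  ... | last w≡2n = critical-2n w w≡2n
  ... | inner {w′} w≡w′+1 w′+2≤2n with suc w′ ≟ penult
  ...   | yes w′+1≡penult = critical-penult below-antepenult antepenult-2n w (trans w≡w′+1 w′+1≡penult)
    where
    below-antepenult : ∀ {a} → a < antepenult → flipsG n k a antepenult ≡ false
    below-antepenult _ rewrite ≥⇒<ᵇ≡false (<⇒≤ 2k+1<antepenult)
                             | ≢⇒≡ᵇ≡false (<⇒≢ (<-trans antepenult<penult penult<2n)) = refl
    antepenult-2n : flipsG n k antepenult (2 * n) ≡ true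
    antepenult-2n rewrite ≡ᵇ-refl (2 * n) = ∨-zeroʳ _
  ...   | no w′+1≢penult = critical-between w w≡w′+1 w′+2≤2n below (λ _ _ → refl)
    where
    w′≢2n : w′ ≢ 2 * n
    w′≢2n = <⇒≢ (<-≤-trans (<-trans (n<1+n w′) (n<1+n (suc w′))) w′+2≤2n)
    w′+2≢2n : suc (suc w′) ≢ 2 * n
    w′+2≢2n w′+2≡2n = w′+1≢penult (suc-injective (trans w′+2≡2n (sym suc-penult)))
    below : isEven w′ ≡ true → ∀ {x} → x < w′ → flipsG n k x w′ ≡ flipsG n k x (suc (suc w′))
    below ew′ _ = cong₂ _∨_
      (<ᵇ-+2ˡ (w≢2k+1 ∘′ trans w≡w′+1) (even≢odd (trans (isEven-+2 w′) ew′) isEven-2k+1))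
      (trans (≢⇒≡ᵇ≡false w′≢2n) (sym (≢⇒≡ᵇ≡false w′+2≢2n)))

  G-minusOneCritical : MinusOneCriticalWithNonCritical (G n k) (2 * k + 1)
  G-minusOneCritical =
    minusOneCritical 1≤k k+2≤n (G-evenReversal n k) (G-indecomposableOn 1≤k k+2≤n) G-critical

module _ {n k : ℕ} (1≤k : 1 ≤ k) (k+2≤n : k + 2 ≤ n) where
  open CriticalityOf 1≤k k+2≤n (H-evenReversal n k (<⇒≤ (Bounds.2k+1<2n 1≤k k+2≤n)))

  private
    flips-to-2k : ∀ u → flipsH n k u (2 * k) ≡ true
    flips-to-2k u rewrite ≡ᵇ-refl (2 * k) = refl

    critical-2k-1 : ∀ w {w′} → toℕ w ≡ suc w′ → suc (suc w′) ≡ 2 * k → Critical (onFin n (Hℕ n k)) w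
    critical-2k-1 w {w′} w≡w′+1 w′+2≡2k =
      critical-by-twins w (<⇒≤ w′<2n) (<⇒≤ 2k+1<2n) ≤-refl (<⇒≢ w′<2k+1)
        (λ w′≡w → <⇒≢ (n<1+n w′) (trans w′≡w w≡w′+1))
        (λ 2k+1≡w → >⇒≢ (<-trans w′+1<2k 2k<2k+1) (trans 2k+1≡w w≡w′+1))
        (λ 2n≡w → >⇒≢ (<-trans (<-trans w′+1<2k 2k<2k+1) 2k+1<2n) (trans 2n≡w w≡w′+1))
        (>⇒≢ w′<2n) (>⇒≢ 2k+1<2n) twins
      where
      w′+1<2k : suc w′ < 2 * k
      w′+1<2k = subst (suc w′ <_) w′+2≡2k ≤-refl
      w′<2k : w′ < 2 * k
      w′<2k = <-trans (n<1+n w′) w′+1<2k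
      w′<2k+1 : w′ < 2 * k + 1
      w′<2k+1 = <-trans w′<2k 2k<2k+1
      w′<2n : w′ < 2 * n
      w′<2n = <-trans w′<2k+1 2k+1<2n
      isEven-w′ : isEven w′ ≡ true
      isEven-w′ = trans (sym (isEven-+2 w′)) (trans (cong isEven w′+2≡2k) isEven-2k)
      twins : ∀ {x} → x ≤ 2 * n → x ≢ w′ → x ≢ 2 * k + 1 → x ≢ toℕ w → Hℕ n k w′ x ≡ Hℕ n k (2 * k + 1) x
      twins {x} _ x≢w′ x≢2k+1 x≢w with <-cmp x w′
      ... | tri≈ _ x≡w′ _ = ⊥-elim (x≢w′ x≡w′)
      ... | tri< x<w′ _ _ = trans (downward x<w′)
          (trans (evenPair-unrelated (flipsH n k) x w′ flips-x-w′)
                 (sym (down-oddʳ (<-trans x<w′ w′<2k+1) isEven-2k+1)))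
        where
        flips-x-w′ : flipsH n k x w′ ≡ false
        flips-x-w′ rewrite ≢⇒≡ᵇ≡false (<⇒≢ w′<2k) | ≢⇒≡ᵇ≡false (<⇒≢ w′<2n) = refl
      ... | tri> _ _ w′<x with <-cmp x (2 * k)
      ...   | tri< x<2k _ _ = ⊥-elim (<⇒≱ x<2k (subst (_≤ x) w′+2≡2k
                (≤∧≢⇒< w′<x (λ w′+1≡x → x≢w (trans (sym w′+1≡x) (sym w≡w′+1))))))
      ...   | tri≈ _ refl _ = trans (up-even w′<2k isEven-w′ isEven-2k (flips-to-2k w′))
                                    (sym (down-oddʳ 2k<2k+1 isEven-2k+1))
      ...   | tri> _ _ 2k<x =
        trans (trans (upward w′<x) (cong not (evenPair-unrelated (flipsH n k) w′ x flips-w′-x)))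
              (sym (up-oddˡ 2k+1<x isEven-2k+1))
        where
        2k+1<x : 2 * k + 1 < x
        2k+1<x = ≤∧≢⇒< (subst (_≤ x) (+-comm 1 (2 * k)) 2k<x) (≢-sym x≢2k+1)
        flips-w′-x : flipsH n k w′ x ≡ false
        flips-w′-x rewrite ≢⇒≡ᵇ≡false (>⇒≢ 2k<x) | <⇒<ᵇ≡true w′<2k = ∧-zeroʳ _

  H-critical : ∀ w → toℕ w ≢ 2 * k + 1 → Critical (onFin n (Hℕ n k)) w
  H-critical w w≢2k+1 with position (toℕ≤2n w)
  ... | first w≡0 = critical-0 w w≡0
  ... | last w≡2n = critical-2n w w≡2n
  ... | inner {w′} w≡w′+1 w′+2≤2n with suc w′ ≟ penult | suc (suc w′) ≟ 2 * k
  ...   | yes w′+1≡penult | _ = critical-penult below-antepenult antepenult-2n w (trans w≡w′+1 w′+1≡penult)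
    where
    below-antepenult : ∀ {a} → a < antepenult → flipsH n k a antepenult ≡ false
    below-antepenult _ rewrite ≢⇒≡ᵇ≡false (>⇒≢ (<-trans 2k<2k+1 2k+1<antepenult))
                             | ≢⇒≡ᵇ≡false (<⇒≢ (<-trans antepenult<penult penult<2n)) = refl
    antepenult-2n : flipsH n k antepenult (2 * n) ≡ true
    antepenult-2n rewrite ≢⇒≡ᵇ≡false (>⇒≢ 2k<2n) | ≡ᵇ-refl (2 * n)
                        | ≥⇒<ᵇ≡false (<⇒≤ (<-trans 2k<2k+1 2k+1<antepenult)) = refl
  ...   | no _ | yes w′+2≡2k = critical-2k-1 w w≡w′+1 w′+2≡2k
  ...   | no w′+1≢penult | no w′+2≢2k = critical-between w w≡w′+1 w′+2≤2n below above
    where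
    w′≢2k : w′ ≢ 2 * k
    w′≢2k w′≡2k = w≢2k+1 (trans w≡w′+1 (trans (cong suc w′≡2k) (+-comm 1 (2 * k))))
    w′≢2n : w′ ≢ 2 * n
    w′≢2n = <⇒≢ (<-≤-trans (<-trans (n<1+n w′) (n<1+n (suc w′))) w′+2≤2n)
    w′+2≢2n : suc (suc w′) ≢ 2 * n
    w′+2≢2n w′+2≡2n = w′+1≢penult (suc-injective (trans w′+2≡2n (sym suc-penult)))
    below : isEven w′ ≡ true → ∀ {x} → x < w′ → flipsH n k x w′ ≡ flipsH n k x (suc (suc w′))
    below _ _ rewrite ≢⇒≡ᵇ≡false w′≢2k | ≢⇒≡ᵇ≡false w′+2≢2k
                    | ≢⇒≡ᵇ≡false w′≢2n | ≢⇒≡ᵇ≡false w′+2≢2n = refl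
    above : isEven w′ ≡ true → ∀ {x} → suc (suc w′) < x → flipsH n k w′ x ≡ flipsH n k (suc (suc w′)) x
    above ew′ {x} _ = cong (λ b → (x ≡ᵇ 2 * k) ∨ ((x ≡ᵇ 2 * n) ∧ not b))
      (<ᵇ-+2ˡ (odd≢even (parity-suc {w′} ew′) isEven-2k) w′+2≢2k)

  H-minusOneCritical : MinusOneCriticalWithNonCritical (H n k) (2 * k + 1)
  H-minusOneCritical = minusOneCritical 1≤k k+2≤n (H-evenReversal n k (<⇒≤ 2k+1<2n))
    (H-indecomposableOn 1≤k k+2≤n) H-critical

proposition4p1 : (n k : ℕ) → 3 ≤ n → 1 ≤ k → k + 2 ≤ n →
    MinusOneCriticalWithNonCritical (E n k) (2 * k + 1) ×
    MinusOneCriticalWithNonCritical (F n k) (2 * k + 1) ×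
    MinusOneCriticalWithNonCritical (G n k) (2 * k + 1) ×
    MinusOneCriticalWithNonCritical (H n k) (2 * k + 1)
proposition4p1 n k _ 1≤k k+2≤n =
  E-minusOneCritical 1≤k k+2≤n , F-minusOneCritical 1≤k k+2≤n ,
  G-minusOneCritical 1≤k k+2≤n , H-minusOneCritical 1≤k k+2≤n
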